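{- Let $\Delta$ be a positive integer, let $G$ be a connected weighted triangle-free graph with weights $w:E(G)\to\mathbb{R}_+$ and maximum degree $\Delta(G)\le\Delta$, and let $M$ be a matching in $G$. Then $\mathrm{mac}(G)\ge\frac{\Delta}{2\Delta-1}\bigl(w(G)-w(M)\bigr)+w(M)$.
   Context: $\mathbb{R}_+$ denotes the non-negative reals; for an edge set or subgraph $H$, $w(H)=\sum_{e\in E(H)}w(e)$. $\mathrm{mac}(G)$ is the maximum total weight of the edges between $A$ and $B$ over all partitions $(A,B)$ of $V(G)$. Triangle-free means containing no $K_3$ subgraph.
   Formalization: The edge weights take nonnegative rational values rather than values in $\mathbb{R}_+$. -}

module Defs where

open import Data.Nat as ℕ using (ℕ; zero; suc)
open import Data.Bool using (Bool; true; false; if_then_else_; _∧_)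
open import Data.Fin using (Fin; zero; suc; toℕ)
open import Data.Vec using (Vec; []; _∷_; lookup)
open import Data.List using (List; []; _∷_; map; foldr; _++_)
open import Data.Integer using (+_)
open import Data.Rational using (ℚ; 0ℚ; _+_; _/_; _⊔_; _≤_)
open import Data.Product using (_×_)
open import Relation.Binary.PropositionalEquality using (_≡_)
open import Relation.Nullary using (¬_)

Σℚ : {n : ℕ} → (Fin n → ℚ) → ℚ
Σℚ {zero}  f = 0ℚ
Σℚ {suc n} f = f zero + Σℚ (λ i → f (suc i))

Σℕ : {n : ℕ} → (Fin n → ℕ) → ℕ
Σℕ {zero}  f = 0
Σℕ {suc n} f = f zero ℕ.+ Σℕ (λ i → f (suc i))

record Graph (n : ℕ) : Set where
  field
    adj   : Fin n → Fin n → Bool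
    sym   : ∀ u v → adj u v ≡ adj v u
    irrefl : ∀ v → adj v v ≡ false
open Graph public

-- Weights w : E(G) → ℚ≥0, represented as a symmetric function on pairs
-- (values on non-edges are irrelevant).
record Weight {n : ℕ} (G : Graph n) : Set where
  field
    w       : Fin n → Fin n → ℚ
    w-sym   : ∀ u v → w u v ≡ w v u
    w-nonneg : ∀ u v → adj G u v ≡ true → 0ℚ ≤ w u v
open Weight public

weightOf : {n : ℕ} → (Fin n → Fin n → Bool) → (Fin n → Fin n → ℚ) → ℚ
weightOf S w = Σℚ (λ u → Σℚ (λ v →
  if S u v ∧ (toℕ u ℕ.<ᵇ toℕ v) then w u v else 0ℚ))

wG : {n : ℕ} (G : Graph n) → Weight G → ℚ
wG G W = weightOf (adj G) (w W)

degree : {n : ℕ} → Graph n → Fin n → ℕ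
degree G u = Σℕ (λ v → if adj G u v then 1 else 0)

data Reach {n : ℕ} (G : Graph n) : Fin n → Fin n → Set where
  here : ∀ {u} → Reach G u u
  step : ∀ {u v x} → adj G u x ≡ true → Reach G x v → Reach G u v

Connected : {n : ℕ} → Graph n → Set
Connected G = ∀ u v → Reach G u v

TriangleFree : {n : ℕ} → Graph n → Set
TriangleFree G = ∀ a b c →
  ¬ (adj G a b ≡ true × adj G b c ≡ true × adj G a c ≡ true)

record Matching {n : ℕ} (G : Graph n) : Set where
  field
    medge    : Fin n → Fin n → Bool
    m-sym    : ∀ u v → medge u v ≡ medge v u
    m-sub    : ∀ u v → medge u v ≡ true → adj G u v ≡ true
    m-unique : ∀ u v v' → medge u v ≡ true → medge u v' ≡ true → v ≡ v'
open Matching public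

wM : {n : ℕ} {G : Graph n} → Weight G → Matching G → ℚ
wM W M = weightOf (medge M) (w W)

-- All subsets of Fin n (as Boolean vectors); a subset A gives the
-- partition (A, V \ A).
allSubsets : (n : ℕ) → List (Vec Bool n)
allSubsets zero    = [] ∷ []
allSubsets (suc n) = map (true ∷_) (allSubsets n) ++ map (false ∷_) (allSubsets n)

differ : Bool → Bool → Bool
differ true  false = true
differ false true  = true
differ _     _     = false

cutWeight : {n : ℕ} (G : Graph n) → Weight G → Vec Bool n → ℚ
cutWeight G W A = weightOf (λ u v → adj G u v ∧ differ (lookup A u) (lookup A v)) (w W)

-- mac(G): maximum cut weight over all partitions (A, B) of V(G).
-- (0 is a valid base for the maximum since cut weights are ≥ 0.)
mac : {n : ℕ} (G : Graph n) → Weight G → ℚ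
mac G W = foldr (λ A m → cutWeight G W A ⊔ m) 0ℚ (allSubsets _)

-- Δ / (2Δ - 1), for Δ ≥ 1 (value at Δ = 0 irrelevant).
coeff : ℕ → ℚ
coeff zero    = 0ℚ
coeff (suc k) = (+ suc k) / suc (2 ℕ.* k)

-- Contract every edge of M. A unit {x, mate x} of the contracted graph G/M meets at most 2Δ − 2
-- other units, so by Vizing's theorem G/M has a proper edge colouring with 2Δ − 1 colours. For a
-- colour c, the c-coloured edges pair units up into blocks; as G is triangle-free, all edges between
-- two adjacent units join their ends in the same pattern, so each block has a 2-colouring making all
-- its internal edges (those of M and those of colour c) bichromatic. Choosing c uniformly and flipping
-- each block's 2-colouring independently at random gives a cut containing all of M and every other
-- edge with probability 1/(2Δ−1) + (2Δ−2)/(2(2Δ−1)) = Δ/(2Δ−1); mac(G) is at least this average.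

module Submission where

open import Data.Bool using (Bool; true; false; not; _∧_; _∨_; _xor_; if_then_else_)
import Data.Bool as Bool
open import Data.Bool.Properties
  using (∧-identityʳ; ∧-zeroʳ; ∧-conicalˡ; ∧-conicalʳ; ∨-comm; ∨-zeroʳ; not-injective; not-involutive; not-¬;
         not-distribˡ-xor; not-distribʳ-xor; xor-annihilates-not)
open import Data.Empty using (⊥; ⊥-elim)
open import Data.Fin using (Fin; zero; suc; toℕ; fromℕ<; join; splitAt)
open import Data.Fin.Permutation.Components using (transpose; transpose-inverse)
open import Data.Fin.Properties
  using (_≟_; any?; suc-injective; 0≢1+n; toℕ-injective; toℕ<n; injective⇒≤; splitAt-join; ≤-totalOrder)
import Data.Integer as ℤ
import Data.Integer.Properties as ℤ
open import Data.List using (List; []; _∷_; map; foldr; cartesianProduct; allFin)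
open import Data.List.Membership.Propositional using (_∈_; _∉_)
open import Data.List.Membership.Propositional.Properties
  using (∈-++⁺ˡ; ∈-++⁺ʳ; ∈-map⁺; ∈-cartesianProduct⁺; ∈-allFin)
open import Data.List.Relation.Binary.Subset.Propositional using (_⊆_)
open import Data.List.Relation.Unary.Any using (here; there)
open import Data.Maybe using (Maybe; just; nothing; _>>=_)
open import Data.Maybe.Properties using (just-injective)
open import Data.Nat using (ℕ; zero; suc; _≤_; _<_; _<ᵇ_; z≤n; s≤s; s≤s⁻¹)
import Data.Nat as ℕ
open import Data.Nat.Properties
  using (≤-refl; ≤-trans; ≤-reflexive; <-≤-trans; <⇒≱; ≮⇒≥; 1+n≰n; n≮0; _<?_; m≤n⇒m≤1+n; m≤n⇒m<n∨m≡n;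
         m≤m+n; +-mono-≤; +-suc; +-identityʳ)
open import Data.Product using (∃; ∃₂; _×_; _,_; proj₁; proj₂; uncurry)
open import Data.Rational using (ℚ; 0ℚ; 1ℚ; ½; _+_; _-_; _*_; _/_; _⊔_; Positive) renaming (_≤_ to _≤ℚ_)
import Data.Rational.Properties as ℚ
open import Data.Rational.Solver using (module +-*-Solver)
import Data.Rational.Unnormalised as ℚᵘ
import Data.Rational.Unnormalised.Properties as ℚᵘ
open import Data.Sum using (_⊎_; inj₁; inj₂)
open import Data.Vec using (Vec; []; _∷_; lookup; tabulate)
open import Data.Vec.Properties using (lookup∘tabulate)
open import Relation.Binary.PropositionalEquality
open ≡-Reasoning
open import Relation.Nullary using (¬_; Dec; yes; no; does)
open import Relation.Nullary.Decidable using (_×-dec_; dec-true; dec-false)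
open import Defs
  using (Σℕ; Σℚ; Graph; adj; irrefl; Weight; w; Matching; medge; m-sym; m-sub; m-unique; degree; Connected;
         TriangleFree; wG; wM; allSubsets; differ; cutWeight; mac; coeff)
  renaming (sym to adj-sym)

true≢false : true ≢ false
true≢false ()

does-true⇒ : ∀ {a} {A : Set a} (d : Dec A) → does d ≡ true → A
does-true⇒ (yes a) _ = a

does-false⇒¬ : ∀ {a} {A : Set a} (d : Dec A) → does d ≡ false → ¬ A
does-false⇒¬ (no ¬a) _ = ¬a

∨-trueˡ : ∀ {x} y → x ≡ true → x ∨ y ≡ true
∨-trueˡ y refl = refl

∨-trueʳ : ∀ x {y} → y ≡ true → x ∨ y ≡ true
∨-trueʳ true _ = refl
∨-trueʳ false e = e

xor-apart : ∀ x {s t} → s ≢ t → (x xor s) xor (x xor t) ≡ true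
xor-apart _ {true} {true} s≢t = ⊥-elim (s≢t refl)
xor-apart _ {false} {false} s≢t = ⊥-elim (s≢t refl)
xor-apart true {true} {false} _ = refl
xor-apart true {false} {true} _ = refl
xor-apart false {true} {false} _ = refl
xor-apart false {false} {true} _ = refl

xor-other-end : ∀ x y → not (y xor x) xor y ≡ not x
xor-other-end true true = refl
xor-other-end true false = refl
xor-other-end false true = refl
xor-other-end false false = refl

-- Counting

count : ∀ {m} → (Fin m → Bool) → ℕ
count P = Σℕ (λ v → if P v then 1 else 0)

_minus_ : ∀ {m} → (Fin m → Bool) → Fin m → Fin m → Bool
(P minus z) v = P v ∧ not (does (v ≟ z))

minus⁺ : ∀ {m} (P : Fin m → Bool) {z v} → P v ≡ true → v ≢ z → (P minus z) v ≡ true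
minus⁺ P {z} {v} Pv v≢z with v ≟ z
... | yes v≡z = ⊥-elim (v≢z v≡z)
... | no _ = trans (∧-identityʳ (P v)) Pv

count-cong : ∀ {m} {P Q : Fin m → Bool} → (∀ v → P v ≡ Q v) → count P ≡ count Q
count-cong {zero} eq = refl
count-cong {suc m} eq = cong₂ ℕ._+_ (cong (λ b → if b then 1 else 0) (eq zero)) (count-cong (λ i → eq (suc i)))

count≤ : ∀ {m} (P : Fin m → Bool) → count P ≤ m
count≤ {zero} P = z≤n
count≤ {suc m} P with P zero
... | true = s≤s (count≤ (λ i → P (suc i)))
... | false = m≤n⇒m≤1+n (count≤ (λ i → P (suc i)))

count-mono : ∀ {m} {P Q : Fin m → Bool} → (∀ v → P v ≡ true → Q v ≡ true) → count P ≤ count Q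
count-mono {zero} P⊆Q = z≤n
count-mono {suc m} {P} {Q} P⊆Q = +-mono-≤ (indicator-mono (P zero) (Q zero) (P⊆Q zero)) (count-mono (λ i → P⊆Q (suc i)))
  where
    indicator-mono : ∀ a b → (a ≡ true → b ≡ true) → (if a then 1 else 0) ≤ (if b then 1 else 0)
    indicator-mono true b a⇒b rewrite a⇒b refl = ≤-refl
    indicator-mono false true _ = z≤n
    indicator-mono false false _ = ≤-refl

count-∨ : ∀ {m} (P Q : Fin m → Bool) → count (λ v → P v ∨ Q v) ≤ count P ℕ.+ count Q
count-∨ {zero} P Q = z≤n
count-∨ {suc m} P Q with P zero | Q zero | count-∨ (λ i → P (suc i)) (λ i → Q (suc i))
... | true | true | ih = s≤s (≤-trans (m≤n⇒m≤1+n ih) (≤-reflexive (sym (+-suc _ _))))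
... | true | false | ih = s≤s ih
... | false | true | ih = ≤-trans (s≤s ih) (≤-reflexive (sym (+-suc _ _)))
... | false | false | ih = ih

count-remove : ∀ {m} (P : Fin m → Bool) {z} → P z ≡ true → count P ≡ suc (count (P minus z))
count-remove {suc m} P {zero} Pz rewrite ∧-zeroʳ (P zero) | Pz =
  cong suc (count-cong (λ i → sym (∧-identityʳ (P (suc i)))))
count-remove {suc m} P {suc z} Pz rewrite ∧-identityʳ (P zero) with P zero
... | true = cong suc (count-remove (λ i → P (suc i)) Pz)
... | false = count-remove (λ i → P (suc i)) Pz

count-< : ∀ {m} {P Q : Fin m → Bool} {z} → (∀ v → P v ≡ true → Q v ≡ true) → P z ≡ false → Q z ≡ true →
          count P < count Q
count-< {P = P} {Q} {z} P⊆Q Pz Qz rewrite count-remove Q Qz =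
  s≤s (count-mono (λ v Pv → minus⁺ Q (P⊆Q v Pv) (λ { refl → true≢false (trans (sym Pv) Pz) })))

count-injective : ∀ {m m′} {P : Fin m → Bool} {Q : Fin m′ → Bool} (g : Fin m → Fin m′) →
                  (∀ v → P v ≡ true → Q (g v) ≡ true) →
                  (∀ u v → P u ≡ true → P v ≡ true → g u ≡ g v → u ≡ v) →
                  count P ≤ count Q
count-injective {zero} g maps inj = z≤n
count-injective {suc m} {P = P} {Q} g maps inj with P zero in P0
... | false = count-injective (λ i → g (suc i)) (λ i → maps (suc i)) (λ u v Pu Pv e → suc-injective (inj _ _ Pu Pv e))
... | true rewrite count-remove Q (maps zero P0) =
  s≤s (count-injective (λ i → g (suc i))
        (λ i Pi → minus⁺ Q (maps (suc i) Pi) (λ e → 0≢1+n (inj _ _ P0 Pi (sym e))))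
        (λ u v Pu Pv e → suc-injective (inj _ _ Pu Pv e)))

count-true : ∀ m → count {m} (λ _ → true) ≡ m
count-true zero = refl
count-true (suc m) = cong suc (count-true m)

-- Edge colourings and Vizing's theorem

module _ {k} {α β : Fin k} where

  transpose-β : transpose α β β ≡ α
  transpose-β with β ≟ α
  ... | yes β≡α = β≡α
  ... | no _ rewrite dec-true (β ≟ β) refl = refl

  transpose-other : ∀ {γ} → γ ≢ α → γ ≢ β → transpose α β γ ≡ γ
  transpose-other {γ} γ≢α γ≢β rewrite dec-false (γ ≟ α) γ≢α | dec-false (γ ≟ β) γ≢β = refl

  transpose-injective : ∀ {γ δ} → transpose α β γ ≡ transpose α β δ → γ ≡ δ
  transpose-injective {γ} {δ} e =
    trans (sym (transpose-inverse β α)) (trans (cong (transpose β α) e) (transpose-inverse β α))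

  transpose⁻¹-α : ∀ {γ} → transpose α β γ ≡ α → γ ≡ β
  transpose⁻¹-α e = transpose-injective (trans e (sym transpose-β))

  transpose⁻¹-other : ∀ {γ δ} → transpose α β γ ≡ δ → δ ≢ α → δ ≢ β → γ ≡ δ
  transpose⁻¹-other e δ≢α δ≢β = transpose-injective (trans e (sym (transpose-other δ≢α δ≢β)))

record ProperColouring {n : ℕ} (E : Fin n → Fin n → Bool) (k : ℕ) : Set where
  field
    colour     : Fin n → Fin n → Fin k
    colour-sym : ∀ a b → colour a b ≡ colour b a
    proper     : ∀ a b b′ → E a b ≡ true → E a b′ ≡ true → colour a b ≡ colour a b′ → b ≡ b′

maxDegree≤1⇒colourable : ∀ {n k} {E : Fin n → Fin n → Bool} → (∀ v → count (E v) ≤ 1) → ProperColouring E (suc k)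
maxDegree≤1⇒colourable {E = E} degree≤1 = record
  { colour = λ _ _ → zero ; colour-sym = λ _ _ → refl ; proper = λ a b b′ e e′ _ → single-neighbour a b b′ e e′ }
  where
    single-neighbour : ∀ a b b′ → E a b ≡ true → E a b′ ≡ true → b ≡ b′
    single-neighbour a b b′ e e′ with b ≟ b′
    ... | yes b≡b′ = b≡b′
    ... | no b≢b′ = ⊥-elim (1+n≰n (≤-trans two≤ (degree≤1 a)))
      where
        two≤ : 2 ≤ count (E a)
        two≤ rewrite count-remove (E a) e | count-remove (E a minus b) (minus⁺ (E a) e′ (λ e → b≢b′ (sym e)))
          = s≤s (s≤s z≤n)

module Vizing {n : ℕ} (E : Fin n → Fin n → Bool)
  (E-sym : ∀ a b → E a b ≡ E b a) (E-irrefl : ∀ a → E a a ≡ false)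
  (k : ℕ) (degree< : ∀ v → count (E v) < k) where

  record PartialColouring : Set where
    field
      coloured     : Fin n → Fin n → Bool
      colour       : Fin n → Fin n → Fin k
      coloured-sym : ∀ a b → coloured a b ≡ coloured b a
      colour-sym   : ∀ a b → colour a b ≡ colour b a
      coloured⇒E   : ∀ a b → coloured a b ≡ true → E a b ≡ true
      proper       : ∀ a b b′ → coloured a b ≡ true → coloured a b′ ≡ true → colour a b ≡ colour a b′ → b ≡ b′
  open PartialColouring public

  Coloured : PartialColouring → Fin k → Fin n → Fin n → Set
  Coloured P γ v u = (coloured P v u ≡ true) × (colour P v u ≡ γ)

  Missing : PartialColouring → Fin n → Fin k → Set
  Missing P v γ = ∀ u → coloured P v u ≡ true → colour P v u ≢ γ

  coloured? : ∀ P γ v u → Dec (Coloured P γ v u)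
  coloured? P γ v u = (coloured P v u Bool.≟ true) ×-dec (colour P v u ≟ γ)

  Coloured-sym : ∀ P {γ v u} → Coloured P γ v u → Coloured P γ u v
  Coloured-sym P {v = v} {u} (c , e) = trans (coloured-sym P u v) c , trans (colour-sym P u v) e

  Coloured-unique : ∀ P {γ v u u′} → Coloured P γ v u → Coloured P γ v u′ → u ≡ u′
  Coloured-unique P (c , e) (c′ , e′) = proper P _ _ _ c c′ (trans e (sym e′))

  missing? : ∀ P v γ → Dec (Missing P v γ)
  missing? P v γ with any? (coloured? P γ v)
  ... | yes (u , c , e) = no (λ m → m u c e)
  ... | no none = yes (λ u c e → none (u , c , e))

  present : ∀ P v γ → ¬ Missing P v γ → ∃ (Coloured P γ v)
  present P v γ ¬m with any? (coloured? P γ v)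
  ... | yes found = found
  ... | no none = ⊥-elim (¬m (λ u c e → none (u , c , e)))

  -- A vertex seeing all k colours would have k distinct neighbours.
  missingColour : ∀ P v → ∃ (Missing P v)
  missingColour P v with any? (missing? P v)
  ... | yes found = found
  ... | no none = ⊥-elim (<⇒≱ (degree< v) (subst (_≤ count (E v)) (count-true k)
                           (count-injective end (λ γ _ → coloured⇒E P v (end γ) (proj₁ (end-coloured γ)))
                                                (λ γ δ _ _ → end-injective))))
    where
      end : Fin k → Fin n
      end γ = proj₁ (present P v γ (λ m → none (γ , m)))
      end-coloured : ∀ γ → Coloured P γ v (end γ)
      end-coloured γ = proj₂ (present P v γ (λ m → none (γ , m)))
      end-injective : ∀ {γ δ} → end γ ≡ end δ → γ ≡ δ
      end-injective {γ} {δ} e =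
        trans (sym (proj₂ (end-coloured γ))) (trans (cong (colour P v) e) (proj₂ (end-coloured δ)))

  KempeClosed : PartialColouring → Fin k → Fin k → (Fin n → Bool) → Set
  KempeClosed P α β K = ∀ a b → K a ≡ true → coloured P a b ≡ true → colour P a b ≡ α ⊎ colour P a b ≡ β → K b ≡ true

  module KempeSwap (P : PartialColouring) {α β : Fin k} (α≢β : α ≢ β)
                   (K : Fin n → Bool) (K-closed : KempeClosed P α β K) where

    swappedColour : Fin n → Fin n → Fin k
    swappedColour a b = if K a ∨ K b then transpose α β (colour P a b) else colour P a b

    swappedColour-inside : ∀ {a} b → K a ≡ true → swappedColour a b ≡ transpose α β (colour P a b)
    swappedColour-inside b Ka rewrite Ka = refl

    swappedColour-outside : ∀ {a b} → K a ≡ false → coloured P a b ≡ true → swappedColour a b ≡ colour P a b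
    swappedColour-outside {a} {b} Ka c rewrite Ka with K b in Kb
    ... | false = refl
    ... | true = transpose-other (λ e → escapes (inj₁ (trans (colour-sym P b a) e)))
                                 (λ e → escapes (inj₂ (trans (colour-sym P b a) e)))
      where
        escapes : colour P b a ≡ α ⊎ colour P b a ≡ β → ⊥
        escapes αβ = true≢false (trans (sym (K-closed b a Kb (trans (coloured-sym P b a) c) αβ)) Ka)

    swappedColour-cases : ∀ a b → swappedColour a b ≡ colour P a b ⊎ swappedColour a b ≡ transpose α β (colour P a b)
    swappedColour-cases a b with K a ∨ K b
    ... | true = inj₂ refl
    ... | false = inj₁ refl

    swappedColour-sym : ∀ a b → swappedColour a b ≡ swappedColour b a
    swappedColour-sym a b rewrite ∨-comm (K a) (K b) | colour-sym P a b = refl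

    swappedColour-proper : ∀ a b b′ → coloured P a b ≡ true → coloured P a b′ ≡ true →
                           swappedColour a b ≡ swappedColour a b′ → b ≡ b′
    swappedColour-proper a b b′ c c′ e = bySide (K a) refl
      where
        bySide : ∀ t → K a ≡ t → b ≡ b′
        bySide true Ka = proper P a b b′ c c′
          (transpose-injective (trans (sym (swappedColour-inside b Ka)) (trans e (swappedColour-inside b′ Ka))))
        bySide false Ka = proper P a b b′ c c′
          (trans (sym (swappedColour-outside Ka c)) (trans e (swappedColour-outside Ka c′)))

    swapped : PartialColouring
    swapped = record
      { coloured = coloured P ; colour = swappedColour
      ; coloured-sym = coloured-sym P ; colour-sym = swappedColour-sym
      ; coloured⇒E = coloured⇒E P ; proper = swappedColour-proper }

    missing-outside : ∀ {v γ} → K v ≡ false → Missing P v γ → Missing swapped v γ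
    missing-outside Kv m u c e = m u c (trans (sym (swappedColour-outside Kv c)) e)

    missing-inside : ∀ {v} → K v ≡ true → Missing P v β → Missing swapped v α
    missing-inside Kv m u c e = m u c (transpose⁻¹-α (trans (sym (swappedColour-inside u Kv)) e))

    missing-other : ∀ {v γ} → γ ≢ α → γ ≢ β → Missing P v γ → Missing swapped v γ
    missing-other {v} γ≢α γ≢β m u c e with swappedColour-cases v u
    ... | inj₁ same = m u c (trans (sym same) e)
    ... | inj₂ moved = m u c (transpose⁻¹-other (trans (sym moved) e) γ≢α γ≢β)

  -- The α/β-Kempe path, traversed as a partial function on states (v , b): from v leave along the
  -- edge coloured α if b is true and β otherwise, then switch b.
  module KempeWalk (P : PartialColouring) {α β : Fin k} (α≢β : α ≢ β) where

    State : Set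
    State = Fin n × Bool

    αβ : Bool → Fin k
    αβ true = α
    αβ false = β

    next : State → Maybe State
    next (v , b) with any? (coloured? P (αβ b) v)
    ... | yes (u , _) = just (u , not b)
    ... | no _ = nothing

    next-sound : ∀ {v b r} → next (v , b) ≡ just r → Coloured P (αβ b) v (proj₁ r) × proj₂ r ≡ not b
    next-sound {v} {b} e with any? (coloured? P (αβ b) v)
    next-sound refl | yes (u , c) = c , refl
    next-sound () | no _

    next-complete : ∀ {v b u} → Coloured P (αβ b) v u → next (v , b) ≡ just (u , not b)
    next-complete {v} {b} {u} c with any? (coloured? P (αβ b) v)
    ... | yes (u′ , c′) = cong (λ w → just (w , not b)) (Coloured-unique P c′ c)
    ... | no none = ⊥-elim (none (u , c))

    next-injective : ∀ {p q r} → next p ≡ just r → next q ≡ just r → p ≡ q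
    next-injective {v , b} {v′ , b′} e e′ with next-sound e | next-sound e′
    ... | c , eb | c′ , eb′ with not-injective (trans (sym eb) eb′)
    ... | refl = cong (_, b) (Coloured-unique P (Coloured-sym P c) (Coloured-sym P c′))

    next-into-start : ∀ {a} → Missing P a β → ∀ p → next p ≢ just (a , true)
    next-into-start {a} m (v , b) e with next-sound e
    next-into-start {a} m (v , false) e | c , _ = m v (proj₁ (Coloured-sym P c)) (proj₂ (Coloured-sym P c))
    next-into-start {a} m (v , true) e | c , ()

    walk : State → ℕ → Maybe State
    walk s zero = just s
    walk s (suc j) = walk s j >>= next

    walk-pred : ∀ s j {r} → walk s (suc j) ≡ just r → ∃ λ r′ → walk s j ≡ just r′ × next r′ ≡ just r
    walk-pred s j e with walk s j
    ... | just r′ = r′ , refl , e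

    walk-prefix : ∀ s {i j r} → i ≤ j → walk s j ≡ just r → ∃ λ r′ → walk s i ≡ just r′
    walk-prefix s {j = zero} {r} z≤n e = r , e
    walk-prefix s {i} {suc j} {r} i≤j e with m≤n⇒m<n∨m≡n i≤j
    ... | inj₂ refl = r , e
    ... | inj₁ i<j = walk-prefix s (s≤s⁻¹ i<j) (proj₁ (proj₂ (walk-pred s j e)))

    Initial : State → Set
    Initial s = ∀ p → next p ≢ just s

    walk-injective : ∀ {s s′} → Initial s → Initial s′ → ∀ i j {r} → walk s i ≡ just r → walk s′ j ≡ just r →
                     i ≡ j × s ≡ s′
    walk-injective init init′ zero zero e e′ = refl , just-injective (trans e (sym e′))
    walk-injective {s′ = s′} init init′ zero (suc j) e e′ with walk-pred s′ j e′
    ... | r′ , _ , st = ⊥-elim (init r′ (trans st (sym e)))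
    walk-injective {s} init init′ (suc i) zero e e′ with walk-pred s i e
    ... | r′ , _ , st = ⊥-elim (init′ r′ (trans st (sym e′)))
    walk-injective {s} {s′} init init′ (suc i) (suc j) e e′ with walk-pred s i e | walk-pred s′ j e′
    ... | r , w , st | r′ , w′ , st′ with next-injective st st′
    ... | refl with walk-injective init init′ i j w w′
    ... | refl , s≡s′ = refl , s≡s′

    private
      tag : State → Fin n ⊎ Fin n
      tag (v , true) = inj₁ v
      tag (v , false) = inj₂ v

      tag-injective : ∀ p q → tag p ≡ tag q → p ≡ q
      tag-injective (v , true) (w , true) refl = refl
      tag-injective (v , false) (w , false) refl = refl
      tag-injective (v , true) (w , false) ()
      tag-injective (v , false) (w , true) ()

      encode : State → Fin (n ℕ.+ n)
      encode p = join n n (tag p)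

      encode-injective : ∀ p q → encode p ≡ encode q → p ≡ q
      encode-injective p q e =
        tag-injective p q (trans (sym (splitAt-join n n (tag p))) (trans (cong (splitAt n) e) (splitAt-join n n (tag q))))

    -- States of a walk from an initial state never repeat, so it has fewer than 2n steps.
    walk-length< : ∀ {s} → Initial s → ∀ j {r} → walk s j ≡ just r → j < n ℕ.+ n
    walk-length< {s} init j {r} e with j <? n ℕ.+ n
    ... | yes j<2n = j<2n
    ... | no j≮2n = ⊥-elim (1+n≰n (injective⇒≤ {f = state} state-injective))
      where
        prefix : (i : Fin (suc (n ℕ.+ n))) → ∃ λ r′ → walk s (toℕ i) ≡ just r′
        prefix i = walk-prefix s (≤-trans (s≤s⁻¹ (toℕ<n i)) (≮⇒≥ j≮2n)) e
        state : Fin (suc (n ℕ.+ n)) → Fin (n ℕ.+ n)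
        state i = encode (proj₁ (prefix i))
        state-injective : ∀ {i i′} → state i ≡ state i′ → i ≡ i′
        state-injective {i} {i′} eq with prefix i | prefix i′
        ... | r , w | r′ , w′ with encode-injective r r′ eq
        ... | refl = toℕ-injective (proj₁ (walk-injective init init (toℕ i) (toℕ i′) w w′))

    at : Maybe State → Fin n → Bool
    at nothing v = false
    at (just (u , _)) v = does (u ≟ v)

    visited : State → ℕ → Fin n → Bool
    visited s zero v = false
    visited s (suc j) v = at (walk s j) v ∨ visited s j v

    visited-sound : ∀ s m v → visited s m v ≡ true → ∃₂ λ j b → walk s j ≡ just (v , b)
    visited-sound s (suc m) v e with walk s m in w
    ... | just (u , b) with u ≟ v
    ...   | yes refl = m , b , w
    ...   | no _ = visited-sound s m v e
    visited-sound s (suc m) v e | nothing = visited-sound s m v e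

    visited-complete : ∀ s {m j v b} → walk s j ≡ just (v , b) → j < m → visited s m v ≡ true
    visited-complete s {suc m} {j} {v} e j<m with m≤n⇒m<n∨m≡n (s≤s⁻¹ j<m)
    ... | inj₂ refl rewrite e | dec-true (v ≟ v) refl = refl
    ... | inj₁ j<m′ rewrite visited-complete s e j<m′ = ∨-zeroʳ (at (walk s m) v)

    module FromMissingβ (a : Fin n) (a-missing : Missing P a β) where

      chain : Fin n → Bool
      chain = visited (a , true) (n ℕ.+ n)

      on-walk⇒chain : ∀ j {v b} → walk (a , true) j ≡ just (v , b) → chain v ≡ true
      on-walk⇒chain j e = visited-complete (a , true) e (walk-length< (next-into-start a-missing) j e)

      start∈chain : chain a ≡ true
      start∈chain = on-walk⇒chain zero refl

      chain-closed : KempeClosed P α β chain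
      chain-closed u w cu c αβ-edge with visited-sound (a , true) (n ℕ.+ n) u cu
      ... | j , b , e with colour P u w ≟ αβ b
      ...   | yes forward = on-walk⇒chain (suc j) (trans (cong (_>>= next) e) (next-complete (c , forward)))
      ...   | no ¬forward = backward j e (other b αβ-edge ¬forward)
        where
          other : ∀ b → colour P u w ≡ α ⊎ colour P u w ≡ β → colour P u w ≢ αβ b → colour P u w ≡ αβ (not b)
          other true (inj₁ e) ne = ⊥-elim (ne e)
          other true (inj₂ e) ne = e
          other false (inj₁ e) ne = e
          other false (inj₂ e) ne = ⊥-elim (ne e)
          backward : ∀ j → walk (a , true) j ≡ just (u , b) → colour P u w ≡ αβ (not b) → chain w ≡ true
          backward zero e q with just-injective e
          ... | refl = ⊥-elim (a-missing w c q)
          backward (suc j) e q with walk-pred (a , true) j e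
          ... | (u′ , b′) , w′ , st with next-sound st
          ... | c′ , refl with Coloured-unique P {u = u′} {u′ = w}
                                 (subst (λ t → Coloured P (αβ t) u u′) (sym (not-involutive b′)) (Coloured-sym P c′)) (c , q)
          ... | refl = on-walk⇒chain j w′

      -- A vertex missing α is the end of the path, so the walk reaches it having just used β.
      missingα⇒reached : ∀ x → Missing P x α → x ≢ a → chain x ≡ true → ∃ λ j → walk (a , true) j ≡ just (x , true)
      missingα⇒reached x m x≢a cx with visited-sound (a , true) (n ℕ.+ n) x cx
      ... | zero , b , e = ⊥-elim (x≢a (sym (cong proj₁ (just-injective e))))
      ... | suc j , b , e with walk-pred (a , true) j e
      ...   | (u , true) , _ , st = ⊥-elim (uncurry (m u) (Coloured-sym P (proj₁ (next-sound st))))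
      ...   | (u , false) , _ , st with next-sound st
      ...     | _ , refl = suc j , e

  -- Shifting a fan: the edges x y for y ∈ Y are recoloured with μ y, which colours the new edge x y0.
  module Rotate (P : PartialColouring) (x y0 : Fin n) (Y : Fin n → Bool) (μ : Fin n → Fin k)
    (y0∈Y : Y y0 ≡ true) (E-xy0 : E x y0 ≡ true) (xy0-uncoloured : coloured P x y0 ≡ false)
    (Y-coloured : ∀ y → Y y ≡ true → y ≢ y0 → coloured P x y ≡ true)
    (μ-missing : ∀ y → Y y ≡ true → Missing P y (μ y))
    (μ-injective : ∀ y y′ → Y y ≡ true → Y y′ ≡ true → μ y ≡ μ y′ → y ≡ y′)
    (μ-fresh : ∀ y z → Y y ≡ true → Y z ≡ false → coloured P x z ≡ true → μ y ≢ colour P x z) where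

    x∉Y : Y x ≡ false
    x∉Y with Y x in Yx
    ... | false = refl
    ... | true with x ≟ y0
    ...   | yes refl = ⊥-elim (true≢false (trans (sym E-xy0) (E-irrefl x)))
    ...   | no x≢y0 = ⊥-elim (true≢false (trans (sym (coloured⇒E P x x (Y-coloured x Yx x≢y0))) (E-irrefl x)))

    x≢y0 : x ≢ y0
    x≢y0 e = true≢false (trans (sym y0∈Y) (trans (cong Y (sym e)) x∉Y))

    isXY0 : Fin n → Fin n → Bool
    isXY0 a b = does (a ≟ x) ∧ does (b ≟ y0)

    isNew : Fin n → Fin n → Bool
    isNew a b = isXY0 a b ∨ isXY0 b a

    rotatedColoured : Fin n → Fin n → Bool
    rotatedColoured a b = coloured P a b ∨ isNew a b

    rotatedColour : Fin n → Fin n → Fin k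
    rotatedColour a b = if does (a ≟ x) then (if Y b then μ b else colour P a b)
                        else (if does (b ≟ x) then (if Y a then μ a else colour P a b) else colour P a b)

    rotatedColour-x : ∀ b → rotatedColour x b ≡ (if Y b then μ b else colour P x b)
    rotatedColour-x b rewrite dec-true (x ≟ x) refl = refl

    rotatedColour-to-x : ∀ a → a ≢ x → rotatedColour a x ≡ (if Y a then μ a else colour P a x)
    rotatedColour-to-x a a≢x rewrite dec-false (a ≟ x) a≢x | dec-true (x ≟ x) refl = refl

    rotatedColour-away : ∀ a b → a ≢ x → b ≢ x → rotatedColour a b ≡ colour P a b
    rotatedColour-away a b a≢x b≢x rewrite dec-false (a ≟ x) a≢x | dec-false (b ≟ x) b≢x = refl

    isXY0⇒ : ∀ a b → isXY0 a b ≡ true → a ≡ x × b ≡ y0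
    isXY0⇒ a b e = does-true⇒ (a ≟ x) (∧-conicalˡ _ _ e) , does-true⇒ (b ≟ y0) (∧-conicalʳ _ _ e)

    isNew⇒ : ∀ a b → isNew a b ≡ true → (a ≡ x × b ≡ y0) ⊎ (a ≡ y0 × b ≡ x)
    isNew⇒ a b e with isXY0 a b in ab
    ... | true = inj₁ (isXY0⇒ a b ab)
    ... | false with isXY0⇒ b a e
    ...   | b≡x , a≡y0 = inj₂ (a≡y0 , b≡x)

    rotatedColoured⇒ : ∀ a b → rotatedColoured a b ≡ true → coloured P a b ≡ true ⊎ (a ≡ x × b ≡ y0) ⊎ (a ≡ y0 × b ≡ x)
    rotatedColoured⇒ a b e with coloured P a b
    ... | true = inj₁ refl
    ... | false = inj₂ (isNew⇒ a b e)

    rotatedColoured-sym : ∀ a b → rotatedColoured a b ≡ rotatedColoured b a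
    rotatedColoured-sym a b rewrite coloured-sym P a b | ∨-comm (isXY0 a b) (isXY0 b a) = refl

    rotatedColour-sym : ∀ a b → rotatedColour a b ≡ rotatedColour b a
    rotatedColour-sym a b = byCase (a ≟ x) (b ≟ x)
      where
        byCase : Dec (a ≡ x) → Dec (b ≡ x) → rotatedColour a b ≡ rotatedColour b a
        byCase (yes refl) (yes refl) = refl
        byCase (yes refl) (no b≢x) =
          trans (rotatedColour-x b) (trans (cong (if Y b then μ b else_) (colour-sym P x b)) (sym (rotatedColour-to-x b b≢x)))
        byCase (no a≢x) (yes refl) =
          trans (rotatedColour-to-x a a≢x) (trans (cong (if Y a then μ a else_) (colour-sym P a x)) (sym (rotatedColour-x a)))
        byCase (no a≢x) (no b≢x) =
          trans (rotatedColour-away a b a≢x b≢x) (trans (colour-sym P a b) (sym (rotatedColour-away b a b≢x a≢x)))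

    rotatedColoured⇒E : ∀ a b → rotatedColoured a b ≡ true → E a b ≡ true
    rotatedColoured⇒E a b e with rotatedColoured⇒ a b e
    ... | inj₁ c = coloured⇒E P a b c
    ... | inj₂ (inj₁ (refl , refl)) = E-xy0
    ... | inj₂ (inj₂ (refl , refl)) = trans (E-sym y0 x) E-xy0

    rotatedColoured-away : ∀ a b → a ≢ x → b ≢ x → rotatedColoured a b ≡ true → coloured P a b ≡ true
    rotatedColoured-away a b a≢x b≢x e with rotatedColoured⇒ a b e
    ... | inj₁ c = c
    ... | inj₂ (inj₁ (a≡x , _)) = ⊥-elim (a≢x a≡x)
    ... | inj₂ (inj₂ (_ , b≡x)) = ⊥-elim (b≢x b≡x)

    rotatedColoured-outside : ∀ b → Y b ≡ false → rotatedColoured x b ≡ true → coloured P x b ≡ true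
    rotatedColoured-outside b Yb e with rotatedColoured⇒ x b e
    ... | inj₁ c = c
    ... | inj₂ (inj₁ (_ , refl)) = ⊥-elim (true≢false (trans (sym y0∈Y) Yb))
    ... | inj₂ (inj₂ (x≡y0 , _)) = ⊥-elim (x≢y0 x≡y0)

    rotatedColour-x∈Y : ∀ b → Y b ≡ true → rotatedColour x b ≡ μ b
    rotatedColour-x∈Y b Yb rewrite rotatedColour-x b | Yb = refl

    rotatedColour-x∉Y : ∀ b → Y b ≡ false → rotatedColour x b ≡ colour P x b
    rotatedColour-x∉Y b Yb rewrite rotatedColour-x b | Yb = refl

    proper-at-x : ∀ b b′ → rotatedColoured x b ≡ true → rotatedColoured x b′ ≡ true →
                  rotatedColour x b ≡ rotatedColour x b′ → b ≡ b′
    proper-at-x b b′ c c′ e = byMembership (Y b) (Y b′) refl refl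
      where
        byMembership : ∀ t t′ → Y b ≡ t → Y b′ ≡ t′ → b ≡ b′
        byMembership true true Yb Yb′ =
          μ-injective b b′ Yb Yb′ (trans (sym (rotatedColour-x∈Y b Yb)) (trans e (rotatedColour-x∈Y b′ Yb′)))
        byMembership true false Yb Yb′ = ⊥-elim (μ-fresh b b′ Yb Yb′ (rotatedColoured-outside b′ Yb′ c′)
          (trans (sym (rotatedColour-x∈Y b Yb)) (trans e (rotatedColour-x∉Y b′ Yb′))))
        byMembership false true Yb Yb′ = ⊥-elim (μ-fresh b′ b Yb′ Yb (rotatedColoured-outside b Yb c)
          (trans (sym (rotatedColour-x∈Y b′ Yb′)) (trans (sym e) (rotatedColour-x∉Y b Yb))))
        byMembership false false Yb Yb′ = proper P x b b′ (rotatedColoured-outside b Yb c) (rotatedColoured-outside b′ Yb′ c′)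
          (trans (sym (rotatedColour-x∉Y b Yb)) (trans e (rotatedColour-x∉Y b′ Yb′)))

    -- Away from x only the edge a x can change colour, and only to a colour missing at a.
    proper-to-x : ∀ a b → a ≢ x → b ≢ x → rotatedColoured a x ≡ true → rotatedColoured a b ≡ true →
                  rotatedColour a x ≢ rotatedColour a b
    proper-to-x a b a≢x b≢x c c′ e = byMembership (Y a) refl
      where
        cab : coloured P a b ≡ true
        cab = rotatedColoured-away a b a≢x b≢x c′
        e′ : rotatedColour a x ≡ colour P a b
        e′ = trans e (rotatedColour-away a b a≢x b≢x)
        atMembership : ∀ {t} → Y a ≡ t → (if t then μ a else colour P a x) ≡ colour P a b
        atMembership Ya =
          subst (λ t → (if t then μ a else colour P a x) ≡ colour P a b) Ya (trans (sym (rotatedColour-to-x a a≢x)) e′)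
        byMembership : ∀ t → Y a ≡ t → ⊥
        byMembership true Ya = μ-missing a Ya b cab (sym (atMembership Ya))
        byMembership false Ya with rotatedColoured⇒ a x c
        ... | inj₁ cax = b≢x (sym (proper P a x b cax cab (atMembership Ya)))
        ... | inj₂ (inj₁ (a≡x , _)) = a≢x a≡x
        ... | inj₂ (inj₂ (refl , _)) = true≢false (trans (sym y0∈Y) Ya)

    rotatedColour-proper : ∀ a b b′ → rotatedColoured a b ≡ true → rotatedColoured a b′ ≡ true →
                           rotatedColour a b ≡ rotatedColour a b′ → b ≡ b′
    rotatedColour-proper a b b′ c c′ e = byCase (a ≟ x) (b ≟ x) (b′ ≟ x)
      where
        byCase : Dec (a ≡ x) → Dec (b ≡ x) → Dec (b′ ≡ x) → b ≡ b′
        byCase (yes refl) _ _ = proper-at-x b b′ c c′ e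
        byCase (no _) (yes refl) (yes refl) = refl
        byCase (no a≢x) (yes refl) (no b′≢x) = ⊥-elim (proper-to-x a b′ a≢x b′≢x c c′ e)
        byCase (no a≢x) (no b≢x) (yes refl) = ⊥-elim (proper-to-x a b a≢x b≢x c′ c (sym e))
        byCase (no a≢x) (no b≢x) (no b′≢x) =
          proper P a b b′ (rotatedColoured-away a b a≢x b≢x c) (rotatedColoured-away a b′ a≢x b′≢x c′)
            (trans (sym (rotatedColour-away a b a≢x b≢x)) (trans e (rotatedColour-away a b′ a≢x b′≢x)))

    rotated : PartialColouring
    rotated = record
      { coloured = rotatedColoured ; colour = rotatedColour
      ; coloured-sym = rotatedColoured-sym ; colour-sym = rotatedColour-sym
      ; coloured⇒E = rotatedColoured⇒E ; proper = rotatedColour-proper }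

    rotated-extends : ∀ a b → coloured P a b ≡ true → coloured rotated a b ≡ true
    rotated-extends a b c rewrite c = refl

    rotated-colours-xy0 : coloured rotated x y0 ≡ true
    rotated-colours-xy0 rewrite dec-true (x ≟ x) refl | dec-true (y0 ≟ y0) refl with coloured P x y0
    ... | true = refl
    ... | false = refl

  open import Data.List.Membership.DecPropositional (_≟_ {n}) using (_∈?_)

  _⊑_ : PartialColouring → PartialColouring → Set
  P ⊑ P′ = ∀ a b → coloured P a b ≡ true → coloured P′ a b ≡ true

  module ColourEdge (P : PartialColouring) (x y0 : Fin n)
                    (E-xy0 : E x y0 ≡ true) (xy0-uncoloured : coloured P x y0 ≡ false) where

    Extension : Set
    Extension = ∃ λ P′ → P ⊑ P′ × coloured P′ x y0 ≡ true

    free : Fin n → Fin k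
    free v = proj₁ (missingColour P v)

    free-missing : ∀ v → Missing P v (free v)
    free-missing v = proj₂ (missingColour P v)

    -- A fan at x, listed from its last vertex back to y0: each x z is coloured with the free colour of
    -- the vertex before z.
    data Fan : List (Fin n) → Set where
      [y0] : Fan (y0 ∷ [])
      grow : ∀ {z y L} → Fan (y ∷ L) → Coloured P (free y) x z → z ∉ y ∷ L → Fan (z ∷ y ∷ L)

    fan-y0 : ∀ {L} → Fan L → y0 ∈ L
    fan-y0 [y0] = here refl
    fan-y0 (grow F _ _) = there (fan-y0 F)

    fan-coloured : ∀ {L y} → Fan L → y ∈ L → y ≢ y0 → coloured P x y ≡ true
    fan-coloured [y0] (here refl) y≢y0 = ⊥-elim (y≢y0 refl)
    fan-coloured (grow F (c , _) _) (here refl) _ = c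
    fan-coloured (grow F _ _) (there y∈L) y≢y0 = fan-coloured F y∈L y≢y0

    fan-E : ∀ {L y} → Fan L → y ∈ L → E x y ≡ true
    fan-E {y = y} F y∈L with y ≟ y0
    ... | yes refl = E-xy0
    ... | no y≢y0 = coloured⇒E P x y (fan-coloured F y∈L y≢y0)

    fan-x∉ : ∀ {L y} → Fan L → y ∈ L → x ≢ y
    fan-x∉ F y∈L refl = true≢false (trans (sym (fan-E F y∈L)) (E-irrefl x))

    fan-next : ∀ {h T y} → Fan (h ∷ T) → y ∈ T → ∃ λ z → z ∈ h ∷ T × Coloured P (free y) x z
    fan-next (grow F c _) (here refl) = _ , here refl , c
    fan-next (grow F _ _) (there y∈T) with fan-next F y∈T
    ... | z , z∈ , c = z , there z∈ , c

    fan-head∉tail : ∀ {h T} → Fan (h ∷ T) → h ∉ T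
    fan-head∉tail [y0] ()
    fan-head∉tail (grow F _ z∉) = z∉

    fan-free-injective : ∀ {h T y y′} → Fan (h ∷ T) → y ∈ T → y′ ∈ T → free y ≡ free y′ → y ≡ y′
    fan-free-injective (grow F c z∉) (here refl) (here refl) e = refl
    fan-free-injective (grow F (c , col) z∉) (here refl) (there y′∈) e with fan-next F y′∈
    ... | z′ , z′∈ , c′ = ⊥-elim (z∉ (subst (_∈ _) (Coloured-unique P c′ (c , trans col e)) z′∈))
    fan-free-injective (grow F (c , col) z∉) (there y∈) (here refl) e with fan-next F y∈
    ... | z′ , z′∈ , c′ = ⊥-elim (z∉ (subst (_∈ _) (Coloured-unique P c′ (c , trans col (sym e))) z′∈))
    fan-free-injective (grow F _ _) (there y∈) (there y′∈) e = fan-free-injective F y∈ y′∈ e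

    fan-prefix : ∀ {h T z} → Fan (h ∷ T) → z ∈ h ∷ T → z ≢ y0 →
                 ∃₂ λ p L′ → Fan (p ∷ L′) × colour P x z ≡ free p × (p ∷ L′) ⊆ T
    fan-prefix [y0] (here refl) z≢y0 = ⊥-elim (z≢y0 refl)
    fan-prefix (grow F (_ , col) _) (here refl) _ = _ , _ , F , col , λ w∈ → w∈
    fan-prefix (grow F _ _) (there z∈) z≢y0 with fan-prefix F z∈ z≢y0
    ... | p , L′ , F′ , col , ⊆T = p , L′ , F′ , col , λ w∈ → there (⊆T w∈)

    -- P′ is P, possibly after a Kempe swap avoiding x. If x and the last fan vertex h miss a common
    -- colour γ, moving every fan edge x y to the colour μ y (γ at h, free y elsewhere) colours x y0.
    module FanRotation (P′ : PartialColouring) {h : Fin n} {T : List (Fin n)} (F : Fan (h ∷ T))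

      (same-coloured : ∀ a b → coloured P′ a b ≡ coloured P a b)

      (same-at-x : ∀ z → coloured P x z ≡ true → colour P′ x z ≡ colour P x z)

      (γ : Fin k) (x-missing : Missing P′ x γ) (h-missing : Missing P′ h γ)

      (T-missing : ∀ y → y ∈ T → Missing P′ y (free y)) where

      Y : Fin n → Bool
      Y y = does (y ∈? h ∷ T)

      μ : Fin n → Fin k
      μ y = if does (y ≟ h) then γ else free y

      Y⇒∈ : ∀ {y} → Y y ≡ true → y ∈ h ∷ T
      Y⇒∈ {y} = does-true⇒ (y ∈? h ∷ T)

      ∉⇒Y : ∀ {y} → Y y ≡ false → y ∉ h ∷ T
      ∉⇒Y {y} = does-false⇒¬ (y ∈? h ∷ T)

      μ-h : μ h ≡ γ
      μ-h rewrite dec-true (h ≟ h) refl = refl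

      μ-tail : ∀ {y} → y ≢ h → μ y ≡ free y
      μ-tail {y} y≢h rewrite dec-false (y ≟ h) y≢h = refl

      head-or-tail : ∀ {y} → y ∈ h ∷ T → y ≡ h ⊎ (y ∈ T × y ≢ h)
      head-or-tail (here e) = inj₁ e
      head-or-tail {y} (there y∈T) with y ≟ h
      ... | yes e = inj₁ e
      ... | no y≢h = inj₂ (y∈T , y≢h)

      γ-not-free : ∀ {y} → y ∈ T → γ ≢ free y
      γ-not-free y∈T e with fan-next F y∈T
      ... | z , _ , (c , col) = x-missing z (trans (same-coloured x z) c) (trans (same-at-x z c) (trans col (sym e)))

      μ-missing : ∀ y → Y y ≡ true → Missing P′ y (μ y)
      μ-missing y Yy with head-or-tail (Y⇒∈ Yy)
      ... | inj₁ refl = subst (Missing P′ h) (sym μ-h) h-missing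
      ... | inj₂ (y∈T , y≢h) = subst (Missing P′ y) (sym (μ-tail y≢h)) (T-missing y y∈T)

      μ-injective : ∀ y y′ → Y y ≡ true → Y y′ ≡ true → μ y ≡ μ y′ → y ≡ y′
      μ-injective y y′ Yy Yy′ e with head-or-tail (Y⇒∈ Yy) | head-or-tail (Y⇒∈ Yy′)
      ... | inj₁ e₁ | inj₁ e₂ = trans e₁ (sym e₂)
      ... | inj₁ refl | inj₂ (y′∈T , y′≢h) = ⊥-elim (γ-not-free y′∈T (trans (sym μ-h) (trans e (μ-tail y′≢h))))
      ... | inj₂ (y∈T , y≢h) | inj₁ refl = ⊥-elim (γ-not-free y∈T (trans (sym μ-h) (trans (sym e) (μ-tail y≢h))))
      ... | inj₂ (y∈T , y≢h) | inj₂ (y′∈T , y′≢h) =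
        fan-free-injective F y∈T y′∈T (trans (sym (μ-tail y≢h)) (trans e (μ-tail y′≢h)))

      μ-fresh : ∀ y z → Y y ≡ true → Y z ≡ false → coloured P′ x z ≡ true → μ y ≢ colour P′ x z
      μ-fresh y z Yy Yz c e with head-or-tail (Y⇒∈ Yy)
      ... | inj₁ refl = x-missing z c (sym (trans (sym μ-h) e))
      ... | inj₂ (y∈T , y≢h) with fan-next F y∈T
      ...   | z′ , z′∈ , (c′ , col′) with proper P′ x z′ z (trans (same-coloured x z′) c′) c
                                        (trans (same-at-x z′ c′) (trans col′ (trans (sym (μ-tail y≢h)) e)))
      ...     | refl = ∉⇒Y Yz z′∈

      module R = Rotate P′ x y0 Y μ (dec-true (y0 ∈? h ∷ T) (fan-y0 F)) E-xy0
                   (trans (same-coloured x y0) xy0-uncoloured)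
                   (λ y Yy y≢y0 → trans (same-coloured x y) (fan-coloured F (Y⇒∈ Yy) y≢y0))
                   μ-missing μ-injective μ-fresh

      extension : Extension
      extension = R.rotated , (λ a b c → R.rotated-extends a b (trans (same-coloured a b) c)) , R.rotated-colours-xy0

    -- x and h miss β = free h, but x has a β-edge back into the fan, to the successor z of some p
    -- with free p = β. With α free at x, the α/β-paths from p and from h cannot both end at x, and a
    -- swap on a suitable one frees α at p or at h.
    module KempeCase {h T} (F : Fan (h ∷ T)) (x-sees-β : ¬ Missing P x (free h)) {z}
                     (cz : coloured P x z ≡ true) (colz : colour P x z ≡ free h) (z∈ : z ∈ h ∷ T) where

      z≢y0 : z ≢ y0
      z≢y0 refl = true≢false (trans (sym cz) xy0-uncoloured)

      prefix : ∃₂ λ p L′ → Fan (p ∷ L′) × colour P x z ≡ free p × (p ∷ L′) ⊆ T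
      prefix = fan-prefix F z∈ z≢y0

      p : Fin n
      p = proj₁ prefix

      L′ : List (Fin n)
      L′ = proj₁ (proj₂ prefix)

      F′ : Fan (p ∷ L′)
      F′ = proj₁ (proj₂ (proj₂ prefix))

      colz′ : colour P x z ≡ free p
      colz′ = proj₁ (proj₂ (proj₂ (proj₂ prefix)))

      ⊆T : (p ∷ L′) ⊆ T
      ⊆T = proj₂ (proj₂ (proj₂ (proj₂ prefix)))

      p≢h : p ≢ h
      p≢h e = fan-head∉tail F (subst (_∈ T) e (⊆T (here refl)))

      L′-not-p : ∀ {y} → y ∈ L′ → y ≢ p
      L′-not-p y∈ e = fan-head∉tail F′ (subst (_∈ L′) e y∈)

      α : Fin k
      α = proj₁ (missingColour P x)

      x-missing-α : Missing P x α
      x-missing-α = proj₂ (missingColour P x)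

      β : Fin k
      β = free h

      α≢β : α ≢ β
      α≢β e = x-sees-β (subst (Missing P x) e x-missing-α)

      free-p≡β : free p ≡ β
      free-p≡β = trans (sym colz′) colz

      p-missing-β : Missing P p β
      p-missing-β = subst (Missing P p) free-p≡β (free-missing p)

      T-not-α : ∀ {y} → y ∈ T → free y ≢ α
      T-not-α y∈ e with fan-next F y∈
      ... | z′ , _ , (c′ , col′) = x-missing-α z′ c′ (trans col′ e)

      T-not-β : ∀ {y} → y ∈ T → y ≢ p → free y ≢ β
      T-not-β y∈ y≢p e = y≢p (fan-free-injective F y∈ (⊆T (here refl)) (trans e (sym free-p≡β)))

      module W = KempeWalk P α≢β

      module Kp = W.FromMissingβ p p-missing-β

      module Kh = W.FromMissingβ h (free-missing h)

      rotate-to-p : (K : Fin n → Bool) → KempeClosed P α β K → K x ≡ false → K p ≡ true → Extension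
      rotate-to-p K K-closed Kx Kp =
        FanRotation.extension S.swapped F′ (λ _ _ → refl) (λ _ c → S.swappedColour-outside Kx c) α
          (S.missing-outside Kx x-missing-α) (S.missing-inside Kp p-missing-β)
          (λ y y∈ → S.missing-other (T-not-α (⊆T (there y∈))) (T-not-β (⊆T (there y∈)) (L′-not-p y∈)) (free-missing y))
        where module S = KempeSwap P α≢β K K-closed

      rotate-to-h : Kh.chain x ≡ false → Kh.chain p ≡ false → Extension
      rotate-to-h Kx Kp =
        FanRotation.extension S.swapped F (λ _ _ → refl) (λ _ c → S.swappedColour-outside Kx c) α
          (S.missing-outside Kx x-missing-α) (S.missing-inside Kh.start∈chain (free-missing h)) tail-missing
        where
          module S = KempeSwap P α≢β Kh.chain Kh.chain-closed
          tail-missing : ∀ y → y ∈ T → Missing S.swapped y (free y)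
          tail-missing y y∈ with y ≟ p
          ... | yes refl = subst (Missing S.swapped p) (sym free-p≡β) (S.missing-outside Kp p-missing-β)
          ... | no y≢p = S.missing-other (T-not-α y∈) (T-not-β y∈ y≢p) (free-missing y)

      both-end-at-x : Kp.chain x ≡ true → Kh.chain x ≡ true → p ≡ h
      both-end-at-x Kpx Khx with Kp.missingα⇒reached x x-missing-α (fan-x∉ F (there (⊆T (here refl)))) Kpx
                               | Kh.missingα⇒reached x x-missing-α (fan-x∉ F (here refl)) Khx
      ... | j , e | j′ , e′ = cong proj₁ (proj₂ (W.walk-injective (W.next-into-start p-missing-β)
                                                   (W.next-into-start (free-missing h)) j j′ e e′))

      extension : Extension
      extension with Kp.chain x in Kpx
      ... | false = rotate-to-p Kp.chain Kp.chain-closed Kpx Kp.start∈chain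
      ... | true with Kh.chain x in Khx
      ...   | true = ⊥-elim (p≢h (both-end-at-x Kpx Khx))
      ...   | false with Kh.chain p in Khp
      ...     | true = rotate-to-p Kh.chain Kh.chain-closed Khx Khp
      ...     | false = rotate-to-h Khx Khp

    fan-step : ∀ {h T} → Fan (h ∷ T) → (∀ {z} → z ∉ h ∷ T → Fan (z ∷ h ∷ T) → Extension) → Extension
    fan-step {h} {T} F continue with missing? P x (free h)
    ... | yes x-missing =
      FanRotation.extension P F (λ _ _ → refl) (λ _ _ → refl) (free h) x-missing (free-missing h) (λ y _ → free-missing y)
    ... | no x-sees with present P x (free h) x-sees
    ...   | z , c with z ∈? h ∷ T
    ...     | yes z∈ = KempeCase.extension F x-sees (proj₁ c) (proj₂ c) z∈
    ...     | no z∉ = continue z∉ (grow F c z∉)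

    outside : List (Fin n) → Fin n → Bool
    outside L v = not (does (v ∈? L))

    outside-shrinks : ∀ {z L} → z ∉ L → count (outside (z ∷ L)) < count (outside L)
    outside-shrinks {z} {L} z∉ =
      count-< outside⊆ (cong not (dec-true (z ∈? z ∷ L) (here refl))) (cong not (dec-false (z ∈? L) z∉))
      where
        outside⊆ : ∀ v → outside (z ∷ L) v ≡ true → outside L v ≡ true
        outside⊆ v e = cong not (dec-false (v ∈? L) (λ v∈ → does-false⇒¬ (v ∈? z ∷ L) (not-injective e) (there v∈)))

    grow-fan : (fuel : ℕ) → ∀ {h T} → Fan (h ∷ T) → count (outside (h ∷ T)) ≤ fuel → Extension
    grow-fan zero F bound = fan-step F (λ z∉ _ → ⊥-elim (n≮0 (<-≤-trans (outside-shrinks z∉) bound)))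
    grow-fan (suc fuel) F bound = fan-step F (λ z∉ F′ → grow-fan fuel F′ (s≤s⁻¹ (<-≤-trans (outside-shrinks z∉) bound)))

    extension : Extension
    extension = grow-fan n [y0] (count≤ _)

  extend : ∀ P a b → ∃ λ P′ → P ⊑ P′ × (E a b ≡ true → coloured P′ a b ≡ true)
  extend P a b with coloured P a b in c | E a b in e
  ... | true | _ = P , (λ _ _ c → c) , (λ _ → c)
  ... | false | false = P , (λ _ _ c → c) , (λ ())
  ... | false | true with ColourEdge.extension P a b e c
  ...   | P′ , P⊑P′ , c′ = P′ , P⊑P′ , (λ _ → c′)

  extendAll : (L : List (Fin n × Fin n)) (P : PartialColouring) →
              ∃ λ P′ → P ⊑ P′ × (∀ {a b} → (a , b) ∈ L → E a b ≡ true → coloured P′ a b ≡ true)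
  extendAll [] P = P , (λ _ _ c → c) , λ ()
  extendAll ((a , b) ∷ L) P with extend P a b
  ... | P₁ , P⊑P₁ , ab with extendAll L P₁
  ...   | P₂ , P₁⊑P₂ , L-coloured = P₂ , (λ u v c → P₁⊑P₂ u v (P⊑P₁ u v c)) , coloured-here-or-there
    where
      coloured-here-or-there : ∀ {u v} → (u , v) ∈ (a , b) ∷ L → E u v ≡ true → coloured P₂ u v ≡ true
      coloured-here-or-there (here refl) e = P₁⊑P₂ _ _ (ab e)
      coloured-here-or-there (there uv∈) e = L-coloured uv∈ e

  uncoloured : PartialColouring
  uncoloured = record
    { coloured = λ _ _ → false ; colour = λ a _ → fromℕ< {0} (≤-trans (s≤s z≤n) (degree< a))
    ; coloured-sym = λ _ _ → refl ; colour-sym = λ _ _ → refl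
    ; coloured⇒E = λ _ _ () ; proper = λ _ _ _ () }

  vizing : ProperColouring E k
  vizing with extendAll (cartesianProduct (allFin n) (allFin n)) uncoloured
  ... | P , _ , all-coloured = record
    { colour = colour P ; colour-sym = colour-sym P
    ; proper = λ a b b′ e e′ → proper P a b b′ (all-coloured (pair∈ a b) e) (all-coloured (pair∈ a b′) e′) }
    where
      pair∈ : ∀ a b → (a , b) ∈ cartesianProduct (allFin n) (allFin n)
      pair∈ a b = ∈-cartesianProduct⁺ (∈-allFin a) (∈-allFin b)

-- Finite sums of rationals

open +-*-Solver

toℚ : ℕ → ℚ
toℚ m = ℤ.+ m / 1

toℚ-+ : ∀ a b → toℚ (a ℕ.+ b) ≡ toℚ a + toℚ b
toℚ-+ a b = ℚ.toℚᵘ-injective (ℚᵘ.≃-trans (ℚ.toℚᵘ-fromℚᵘ (ℚᵘ.mkℚᵘ (ℤ.+ (a ℕ.+ b)) 0))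
  (ℚᵘ.≃-trans (ℚᵘ.*≡* integer-identity)
  (ℚᵘ.≃-sym (ℚᵘ.≃-trans (ℚ.toℚᵘ-homo-+ (toℚ a) (toℚ b))
     (ℚᵘ.+-cong (ℚ.toℚᵘ-fromℚᵘ (ℚᵘ.mkℚᵘ (ℤ.+ a) 0)) (ℚ.toℚᵘ-fromℚᵘ (ℚᵘ.mkℚᵘ (ℤ.+ b) 0)))))))
  where
    integer-identity : (ℤ.+ (a ℕ.+ b)) ℤ.* (ℤ.+ 1) ≡ ((ℤ.+ a) ℤ.* (ℤ.+ 1) ℤ.+ (ℤ.+ b) ℤ.* (ℤ.+ 1)) ℤ.* (ℤ.+ 1)
    integer-identity rewrite ℤ.*-identityʳ (ℤ.+ a) | ℤ.*-identityʳ (ℤ.+ b) = cong (ℤ._* (ℤ.+ 1)) (ℤ.pos-+ a b)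

coeff-suc : ∀ d → coeff (suc d) * toℚ (suc (2 ℕ.* d)) ≡ toℚ (suc d)
coeff-suc d = ℚ.toℚᵘ-injective (ℚᵘ.≃-trans (ℚ.toℚᵘ-homo-* (coeff (suc d)) (toℚ (suc (2 ℕ.* d))))
  (ℚᵘ.≃-trans (ℚᵘ.*-cong (ℚ.toℚᵘ-fromℚᵘ (ℚᵘ.mkℚᵘ (ℤ.+ suc d) (2 ℕ.* d))) (ℚ.toℚᵘ-fromℚᵘ (ℚᵘ.mkℚᵘ (ℤ.+ suc (2 ℕ.* d)) 0)))
  (ℚᵘ.≃-trans (ℚᵘ.*≡* (ℤ.*-assoc (ℤ.+ suc d) (ℤ.+ suc (2 ℕ.* d)) (ℤ.+ 1)))
  (ℚᵘ.≃-sym (ℚ.toℚᵘ-fromℚᵘ (ℚᵘ.mkℚᵘ (ℤ.+ suc d) 0))))))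

Σℚ-cong : ∀ {m} {f g : Fin m → ℚ} → (∀ i → f i ≡ g i) → Σℚ f ≡ Σℚ g
Σℚ-cong {zero} eq = refl
Σℚ-cong {suc m} eq = cong₂ _+_ (eq zero) (Σℚ-cong (λ i → eq (suc i)))

Σℚ-mono : ∀ {m} {f g : Fin m → ℚ} → (∀ i → f i ≤ℚ g i) → Σℚ f ≤ℚ Σℚ g
Σℚ-mono {zero} le = ℚ.≤-refl
Σℚ-mono {suc m} le = ℚ.+-mono-≤ (le zero) (Σℚ-mono (λ i → le (suc i)))

Σℚ-+ : ∀ {m} (f g : Fin m → ℚ) → Σℚ (λ i → f i + g i) ≡ Σℚ f + Σℚ g
Σℚ-+ {zero} f g = refl
Σℚ-+ {suc m} f g = trans (cong ((f zero + g zero) +_) (Σℚ-+ (λ i → f (suc i)) (λ i → g (suc i))))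
  (solve 4 (λ a b c d → (a :+ b) :+ (c :+ d) := (a :+ c) :+ (b :+ d)) refl (f zero) (g zero) _ _)

Σℚ-*ˡ : ∀ {m} q (f : Fin m → ℚ) → Σℚ (λ i → q * f i) ≡ q * Σℚ f
Σℚ-*ˡ {zero} q f = sym (ℚ.*-zeroʳ q)
Σℚ-*ˡ {suc m} q f = trans (cong (q * f zero +_) (Σℚ-*ˡ q (λ i → f (suc i)))) (sym (ℚ.*-distribˡ-+ q (f zero) _))

Σℚ-const : ∀ m q → Σℚ {m} (λ _ → q) ≡ toℚ m * q
Σℚ-const zero q = sym (ℚ.*-zeroˡ q)
Σℚ-const (suc m) q = trans (cong (q +_) (Σℚ-const m q))
  (trans (solve 2 (λ q x → q :+ x :* q := (con 1ℚ :+ x) :* q) refl q (toℚ m)) (cong (_* q) (sym (toℚ-+ 1 m))))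

Σℚ-swap : ∀ {m p} (f : Fin m → Fin p → ℚ) → Σℚ (λ i → Σℚ (f i)) ≡ Σℚ (λ j → Σℚ (λ i → f i j))
Σℚ-swap {zero} {p} f = trans (sym (ℚ.*-zeroʳ (toℚ p))) (sym (Σℚ-const p 0ℚ))
Σℚ-swap {suc m} f = trans (cong (Σℚ (f zero) +_) (Σℚ-swap (λ i → f (suc i))))
  (sym (Σℚ-+ (f zero) (λ j → Σℚ (λ i → f (suc i) j))))

Σℚ-except : ∀ {m} (f : Fin (suc m) → ℚ) c₀ {q} → (∀ c → c ≢ c₀ → f c ≡ q) → Σℚ f ≡ f c₀ + toℚ m * q
Σℚ-except {m} f zero {q} others = cong (f zero +_) (trans (Σℚ-cong (λ i → others (suc i) (λ ()))) (Σℚ-const m q))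
Σℚ-except {suc m} f (suc c₀) {q} others =
  trans (cong₂ _+_ (others zero (λ ()))
                   (Σℚ-except (λ i → f (suc i)) c₀ (λ c c≢ → others (suc c) (λ e → c≢ (suc-injective e)))))
        (trans (solve 3 (λ q a x → q :+ (a :+ x :* q) := a :+ (con 1ℚ :+ x) :* q) refl q (f (suc c₀)) (toℚ m))
               (cong (λ t → f (suc c₀) + t * q) (sym (toℚ-+ 1 m))))

Σᵛ : ∀ {n} → (Vec Bool n → ℚ) → ℚ
Σᵛ {zero} f = f []
Σᵛ {suc n} f = Σᵛ (λ X → f (true ∷ X)) + Σᵛ (λ X → f (false ∷ X))

Σᵛ-cong : ∀ {n} {f g : Vec Bool n → ℚ} → (∀ X → f X ≡ g X) → Σᵛ f ≡ Σᵛ g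
Σᵛ-cong {zero} eq = eq []
Σᵛ-cong {suc n} eq = cong₂ _+_ (Σᵛ-cong (λ X → eq (true ∷ X))) (Σᵛ-cong (λ X → eq (false ∷ X)))

Σᵛ-mono : ∀ {n} {f g : Vec Bool n → ℚ} → (∀ X → f X ≤ℚ g X) → Σᵛ f ≤ℚ Σᵛ g
Σᵛ-mono {zero} le = le []
Σᵛ-mono {suc n} le = ℚ.+-mono-≤ (Σᵛ-mono (λ X → le (true ∷ X))) (Σᵛ-mono (λ X → le (false ∷ X)))

Σᵛ-+ : ∀ {n} (f g : Vec Bool n → ℚ) → Σᵛ (λ X → f X + g X) ≡ Σᵛ f + Σᵛ g
Σᵛ-+ {zero} f g = refl
Σᵛ-+ {suc n} f g =
  trans (cong₂ _+_ (Σᵛ-+ {n} (λ X → f (true ∷ X)) (λ X → g (true ∷ X))) (Σᵛ-+ {n} (λ X → f (false ∷ X)) (λ X → g (false ∷ X))))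
        (solve 4 (λ a b c d → (a :+ b) :+ (c :+ d) := (a :+ c) :+ (b :+ d)) refl
               (Σᵛ {n} (λ X → f (true ∷ X))) (Σᵛ {n} (λ X → g (true ∷ X)))
               (Σᵛ {n} (λ X → f (false ∷ X))) (Σᵛ {n} (λ X → g (false ∷ X))))

Σᵛ-*ʳ : ∀ {n} (f : Vec Bool n → ℚ) q → Σᵛ (λ X → f X * q) ≡ Σᵛ f * q
Σᵛ-*ʳ {zero} f q = refl
Σᵛ-*ʳ {suc n} f q =
  trans (cong₂ _+_ (Σᵛ-*ʳ {n} (λ X → f (true ∷ X)) q) (Σᵛ-*ʳ {n} (λ X → f (false ∷ X)) q))
        (sym (ℚ.*-distribʳ-+ q (Σᵛ {n} (λ X → f (true ∷ X))) (Σᵛ {n} (λ X → f (false ∷ X)))))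

Σᵛ-Σℚ : ∀ {n m} (f : Vec Bool n → Fin m → ℚ) → Σᵛ (λ X → Σℚ (f X)) ≡ Σℚ (λ i → Σᵛ (λ X → f X i))
Σᵛ-Σℚ {zero} f = refl
Σᵛ-Σℚ {suc n} f = trans (cong₂ _+_ (Σᵛ-Σℚ (λ X → f (true ∷ X))) (Σᵛ-Σℚ (λ X → f (false ∷ X))))
  (sym (Σℚ-+ (λ i → Σᵛ (λ X → f (true ∷ X) i)) (λ i → Σᵛ (λ X → f (false ∷ X) i))))

Σᵛ-1-positive : ∀ n → Positive (Σᵛ {n} (λ _ → 1ℚ))
Σᵛ-1-positive zero = _
Σᵛ-1-positive (suc n) = ℚ.pos+pos⇒pos (Σᵛ {n} (λ _ → 1ℚ)) {{Σᵛ-1-positive n}} (Σᵛ {n} (λ _ → 1ℚ)) {{Σᵛ-1-positive n}}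

Σᵛ-complementary : ∀ {n} (P : Vec Bool n → Bool) q →
  Σᵛ (λ X → if not (P X) then q else 0ℚ) + Σᵛ (λ X → if P X then q else 0ℚ) ≡ ½ * (Σᵛ {n} (λ _ → q) + Σᵛ {n} (λ _ → q))
Σᵛ-complementary {n} P q =
  trans (sym (Σᵛ-+ (λ X → if not (P X) then q else 0ℚ) (λ X → if P X then q else 0ℚ)))
  (trans (Σᵛ-cong (λ X → either (P X)))
         (solve 1 (λ x → x := con ½ :* (x :+ x)) refl (Σᵛ {n} (λ _ → q))))
  where
    either : ∀ b → (if not b then q else 0ℚ) + (if b then q else 0ℚ) ≡ q
    either true = ℚ.+-identityˡ q
    either false = ℚ.+-identityʳ q

Σᵛ-separated : ∀ {n} {a b : Fin n} → a ≢ b → ∀ s t q →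
  Σᵛ (λ X → if (lookup X a xor s) xor (lookup X b xor t) then q else 0ℚ) ≡ ½ * Σᵛ {n} (λ _ → q)
Σᵛ-separated {suc n} {zero} {zero} a≢b = ⊥-elim (a≢b refl)
Σᵛ-separated {suc n} {zero} {suc b} _ s t q =
  trans (cong (_+ Σᵛ (λ X → if s xor (lookup X b xor t) then q else 0ℚ))
          (Σᵛ-cong (λ X → cong (if_then q else 0ℚ) (sym (not-distribˡ-xor s (lookup X b xor t))))))
        (Σᵛ-complementary (λ X → s xor (lookup X b xor t)) q)
Σᵛ-separated {suc n} {suc a} {zero} _ s t q =
  trans (cong (_+ Σᵛ (λ X → if (lookup X a xor s) xor t then q else 0ℚ))
          (Σᵛ-cong (λ X → cong (if_then q else 0ℚ) (sym (not-distribʳ-xor (lookup X a xor s) t)))))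
        (Σᵛ-complementary (λ X → (lookup X a xor s) xor t) q)
Σᵛ-separated {suc n} {suc a} {suc b} a≢b s t q =
  trans (cong₂ _+_ (Σᵛ-separated {n} {a} {b} (λ e → a≢b (cong suc e)) s t q)
                   (Σᵛ-separated {n} {a} {b} (λ e → a≢b (cong suc e)) s t q))
        (sym (ℚ.*-distribˡ-+ ½ (Σᵛ {n} (λ _ → q)) (Σᵛ {n} (λ _ → q))))

Σᵛ-const : ∀ {n} q → Σᵛ {n} (λ _ → q) ≡ Σᵛ {n} (λ _ → 1ℚ) * q
Σᵛ-const {n} q = trans (Σᵛ-cong {n} (λ _ → sym (ℚ.*-identityˡ q))) (Σᵛ-*ʳ {n} (λ _ → 1ℚ) q)

Σℚ-linear : ∀ {m} a b c (f g : Fin m → ℚ) → Σℚ (λ i → a * (b * f i + c * g i)) ≡ a * (b * Σℚ f + c * Σℚ g)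
Σℚ-linear a b c f g = trans (Σℚ-*ˡ a (λ i → b * f i + c * g i))
  (cong (a *_) (trans (Σℚ-+ (λ i → b * f i) (λ i → c * g i)) (cong₂ _+_ (Σℚ-*ˡ b f) (Σℚ-*ˡ c g))))

-- The contracted graph G/M

module Contraction {n : ℕ} (G : Graph n) (M : Matching G) where

  open import Algebra.Construct.NaturalChoice.Min (≤-totalOrder n) public using (_⊓_; ⊓-comm; ⊓-sel)

  -- An unmatched vertex is its own mate.
  opaque
    mate : Fin n → Fin n
    mate v with any? (λ u → medge M v u Bool.≟ true)
    ... | yes (u , _) = u
    ... | no _ = v

    mate-cases : ∀ v → medge M v (mate v) ≡ true ⊎ (mate v ≡ v × ∀ u → medge M v u ≢ true)
    mate-cases v with any? (λ u → medge M v u Bool.≟ true)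
    ... | yes (_ , m) = inj₁ m
    ... | no none = inj₂ (refl , λ u m → none (u , m))

  medge⇒mate : ∀ {v u} → medge M v u ≡ true → mate v ≡ u
  medge⇒mate {v} {u} m with mate-cases v
  ... | inj₁ m′ = m-unique M v (mate v) u m′ m
  ... | inj₂ (_ , none) = ⊥-elim (none u m)

  mate-involutive : ∀ v → mate (mate v) ≡ v
  mate-involutive v with mate-cases v
  ... | inj₁ m = medge⇒mate (trans (m-sym M (mate v) v) m)
  ... | inj₂ (e , _) = trans (cong mate e) e

  matched⇒medge : ∀ {v} → mate v ≢ v → medge M v (mate v) ≡ true
  matched⇒medge {v} matched with mate-cases v
  ... | inj₁ m = m
  ... | inj₂ (e , _) = ⊥-elim (matched e)

  matched⇒adj : ∀ {v} → mate v ≢ v → adj G v (mate v) ≡ true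
  matched⇒adj {v} matched = m-sub M v (mate v) (matched⇒medge matched)

  medge⇒matched : ∀ {u v} → medge M u v ≡ true → mate u ≢ u
  medge⇒matched {u} m e =
    true≢false (trans (sym (subst (λ z → adj G u z ≡ true) (trans (sym (medge⇒mate m)) e) (m-sub M u _ m))) (irrefl G u))

  -- The contracted graph G / M has one vertex per unit {v, mate v}, represented by its smaller element.
  opaque
    rep : Fin n → Fin n
    rep v = v ⊓ mate v

    rep-cases : ∀ v → rep v ≡ v ⊎ rep v ≡ mate v
    rep-cases v = ⊓-sel v (mate v)

    rep-mate : ∀ v → rep (mate v) ≡ rep v
    rep-mate v = trans (cong (mate v ⊓_) (mate-involutive v)) (⊓-comm (mate v) v)

  rep-idempotent : ∀ v → rep (rep v) ≡ rep v
  rep-idempotent v with rep-cases v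
  ... | inj₁ e = cong rep e
  ... | inj₂ e = trans (cong rep e) (rep-mate v)

  unit-cases : ∀ v → v ≡ rep v ⊎ v ≡ mate (rep v)
  unit-cases v with rep-cases v
  ... | inj₁ e = inj₁ (sym e)
  ... | inj₂ e = inj₂ (sym (trans (cong mate e) (mate-involutive v)))

  same-unit : ∀ {u v} → rep u ≡ rep v → u ≡ v ⊎ (v ≡ mate u × mate u ≢ u)
  same-unit {u} {v} e with u ≟ v
  ... | yes u≡v = inj₁ u≡v
  ... | no u≢v = inj₂ (v≡mate-u , λ m → u≢v (trans (sym m) (sym v≡mate-u)))
    where
      v≡mate-u : v ≡ mate u
      v≡mate-u with unit-cases u | unit-cases v
      ... | inj₁ a | inj₁ b = ⊥-elim (u≢v (trans a (trans e (sym b))))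
      ... | inj₁ a | inj₂ b = trans b (cong mate (trans (sym e) (sym a)))
      ... | inj₂ a | inj₁ b = sym (trans (cong mate a) (trans (mate-involutive (rep u)) (trans e (sym b))))
      ... | inj₂ a | inj₂ b = ⊥-elim (u≢v (trans a (trans (cong mate e) (sym b))))

  notRep : Fin n → Bool
  notRep v = not (does (v ≟ rep v))

  notRep-mate : ∀ {u} → mate u ≢ u → notRep (mate u) ≡ not (notRep u)
  notRep-mate {u} matched with unit-cases u
  ... | inj₁ u≡r rewrite dec-true (u ≟ rep u) u≡r
                       | dec-false (mate u ≟ rep (mate u)) (λ e → matched (trans e (trans (rep-mate u) (sym u≡r)))) = refl
  ... | inj₂ u≡m rewrite dec-false (u ≟ rep u) (λ e → matched (trans (cong mate e) (sym u≡m)))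
                       | dec-true (mate u ≟ rep (mate u))
                                  (trans (cong mate u≡m) (trans (mate-involutive (rep u)) (sym (rep-mate u)))) = refl

  isRep : Fin n → Bool
  isRep r = does (rep r ≟ r)

  unitsAdjacent : Fin n → Fin n → Bool
  unitsAdjacent r s = adj G r s ∨ adj G r (mate s) ∨ adj G (mate r) s ∨ adj G (mate r) (mate s)

  contracted : Fin n → Fin n → Bool
  contracted r s = isRep r ∧ isRep s ∧ not (does (r ≟ s)) ∧ unitsAdjacent r s

  does-≟-sym : ∀ (r s : Fin n) → does (r ≟ s) ≡ does (s ≟ r)
  does-≟-sym r s with r ≟ s | s ≟ r
  ... | yes _ | yes _ = refl
  ... | no _ | no _ = refl
  ... | yes e | no ne = ⊥-elim (ne (sym e))
  ... | no ne | yes e = ⊥-elim (ne (sym e))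

  unitsAdjacent-sym : ∀ r s → unitsAdjacent r s ≡ unitsAdjacent s r
  unitsAdjacent-sym r s rewrite adj-sym G s r | adj-sym G s (mate r) | adj-sym G (mate s) r | adj-sym G (mate s) (mate r) =
    middle-swap (adj G r s) (adj G r (mate s)) (adj G (mate r) s) (adj G (mate r) (mate s))
    where
      middle-swap : ∀ a b c d → a ∨ b ∨ c ∨ d ≡ a ∨ c ∨ b ∨ d
      middle-swap true b c d = refl
      middle-swap false true true d = refl
      middle-swap false true false d = refl
      middle-swap false false c d = refl

  contracted-sym : ∀ r s → contracted r s ≡ contracted s r
  contracted-sym r s rewrite does-≟-sym r s | unitsAdjacent-sym r s with isRep r | isRep s
  ... | true | true = refl
  ... | true | false = refl
  ... | false | true = refl
  ... | false | false = refl

  contracted-irrefl : ∀ r → contracted r r ≡ false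
  contracted-irrefl r rewrite dec-true (r ≟ r) refl with isRep r
  ... | true = refl
  ... | false = refl

  record Contracted (r s : Fin n) : Set where
    field
      rep-r    : rep r ≡ r
      rep-s    : rep s ≡ s
      r≢s      : r ≢ s
      adjacent : unitsAdjacent r s ≡ true

  contracted⇒ : ∀ {r s} → contracted r s ≡ true → Contracted r s
  contracted⇒ {r} {s} e = record
    { rep-r = does-true⇒ (rep r ≟ r) (∧-conicalˡ _ _ e)
    ; rep-s = does-true⇒ (rep s ≟ s) (∧-conicalˡ _ _ e₁)
    ; r≢s = λ r≡s → true≢false (trans (sym (∧-conicalˡ _ _ e₂)) (cong not (dec-true (r ≟ s) r≡s)))
    ; adjacent = ∧-conicalʳ _ _ e₂ }
    where
      e₁ = ∧-conicalʳ (isRep r) _ e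
      e₂ = ∧-conicalʳ (isRep s) _ e₁

  non-matching-edge⇒distinct-units : ∀ {u v} → adj G u v ≡ true → medge M u v ≡ false → rep u ≢ rep v
  non-matching-edge⇒distinct-units {u} {v} a m e with same-unit {u} {v} e
  ... | inj₁ refl = true≢false (trans (sym a) (irrefl G u))
  ... | inj₂ (refl , matched) = true≢false (trans (sym (matched⇒medge matched)) m)

  edge⇒unitsAdjacent : ∀ {u v} → adj G u v ≡ true → unitsAdjacent (rep u) (rep v) ≡ true
  edge⇒unitsAdjacent {u} {v} a with unit-cases u | unit-cases v
  ... | inj₁ p | inj₁ q = ∨-trueˡ _ (subst₂ (λ x y → adj G x y ≡ true) p q a)
  ... | inj₁ p | inj₂ q = ∨-trueʳ (adj G _ _) (∨-trueˡ _ (subst₂ (λ x y → adj G x y ≡ true) p q a))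
  ... | inj₂ p | inj₁ q = ∨-trueʳ (adj G _ _) (∨-trueʳ (adj G _ _) (∨-trueˡ _ (subst₂ (λ x y → adj G x y ≡ true) p q a)))
  ... | inj₂ p | inj₂ q =
    ∨-trueʳ (adj G _ _) (∨-trueʳ (adj G _ _) (∨-trueʳ (adj G _ _) (subst₂ (λ x y → adj G x y ≡ true) p q a)))

  edge⇒contracted : ∀ {u v} → adj G u v ≡ true → medge M u v ≡ false → contracted (rep u) (rep v) ≡ true
  edge⇒contracted {u} {v} a m
    rewrite dec-true (rep (rep u) ≟ rep u) (rep-idempotent u) | dec-true (rep (rep v) ≟ rep v) (rep-idempotent v)
          | dec-false (rep u ≟ rep v) (non-matching-edge⇒distinct-units a m) = edge⇒unitsAdjacent a

  private
    sum-of-two-below : ∀ {a b D} → a < D → b < D → a ℕ.+ b ≤ D ℕ.+ (D ℕ.∸ 2)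
    sum-of-two-below {D = suc zero} (s≤s z≤n) (s≤s z≤n) = z≤n
    sum-of-two-below {a} {b} {suc (suc e)} (s≤s a≤) (s≤s b≤) =
      ≤-trans (+-mono-≤ a≤ b≤) (≤-reflexive (cong suc (+-suc e e)))

  -- Every unit adjacent to the unit of x is reached through its own neighbour of x or of mate x.
  module Towards (x : Fin n) where

    towards : Fin n → Fin n
    towards y = if adj G x y ∨ adj G (mate x) y then y else mate y

    towards-cases : ∀ y → (towards y ≡ y × adj G x y ∨ adj G (mate x) y ≡ true) ⊎
                          (towards y ≡ mate y × adj G x y ∨ adj G (mate x) y ≡ false)
    towards-cases y with adj G x y ∨ adj G (mate x) y
    ... | true = inj₁ (refl , refl)
    ... | false = inj₂ (refl , refl)

    rep-towards : ∀ y → rep y ≡ y → rep (towards y) ≡ y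
    rep-towards y r with towards-cases y
    ... | inj₁ (e , _) = trans (cong rep e) r
    ... | inj₂ (e , _) = trans (cong rep e) (trans (rep-mate y) r)

    towards-injective : ∀ y y′ → contracted x y ≡ true → contracted x y′ ≡ true → towards y ≡ towards y′ → y ≡ y′
    towards-injective y y′ c c′ e =
      trans (sym (rep-towards y (Contracted.rep-s (contracted⇒ {x} {y} c))))
            (trans (cong rep e) (rep-towards y′ (Contracted.rep-s (contracted⇒ {x} {y′} c′))))

    neighbours : Fin n → Bool
    neighbours v = (adj G x minus mate x) v ∨ (adj G (mate x) minus x) v

    towards-adj : ∀ y → unitsAdjacent x y ≡ true → adj G x (towards y) ≡ true ⊎ adj G (mate x) (towards y) ≡ true
    towards-adj y ua with towards-cases y
    ... | inj₁ (t , e) rewrite t = split (adj G x y) e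
      where
        split : ∀ b → b ∨ adj G (mate x) y ≡ true → b ≡ true ⊎ adj G (mate x) y ≡ true
        split true _ = inj₁ refl
        split false e = inj₂ e
    ... | inj₂ (t , e) rewrite t = across (adj G x y) (adj G (mate x) y) e ua
      where
        across : ∀ a b → a ∨ b ≡ false → a ∨ adj G x (mate y) ∨ b ∨ adj G (mate x) (mate y) ≡ true →
                 adj G x (mate y) ≡ true ⊎ adj G (mate x) (mate y) ≡ true
        across false false _ h with adj G x (mate y)
        ... | true = inj₁ refl
        ... | false = inj₂ h

    towards-outside-unit : ∀ y → contracted x y ≡ true → towards y ≢ x × towards y ≢ mate x
    towards-outside-unit y c = (λ e → r≢s (from-rep (cong rep (sym e))))
                             , (λ e → r≢s (from-rep (trans (sym (rep-mate x)) (cong rep (sym e)))))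
      where
        open Contracted (contracted⇒ {x} {y} c)
        from-rep : rep x ≡ rep (towards y) → x ≡ y
        from-rep e = trans (sym rep-r) (trans e (rep-towards y rep-s))

    towards-neighbour : ∀ y → contracted x y ≡ true → neighbours (towards y) ≡ true
    towards-neighbour y c with towards-adj y (Contracted.adjacent (contracted⇒ {x} {y} c))
    ... | inj₁ a = ∨-trueˡ _ (minus⁺ (adj G x) a (proj₂ (towards-outside-unit y c)))
    ... | inj₂ a = ∨-trueʳ _ (minus⁺ (adj G (mate x)) a (proj₁ (towards-outside-unit y c)))

  neighbours-bound : ∀ {Δ} → (∀ v → degree G v ≤ Δ) → ∀ x → count (Towards.neighbours x) ≤ Δ ℕ.+ (Δ ℕ.∸ 2)
  neighbours-bound {Δ} degree≤ x with mate x ≟ x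
  ... | yes unmatched = ≤-trans (count-mono ⊆adj) (≤-trans (degree≤ x) (m≤m+n Δ (Δ ℕ.∸ 2)))
    where
      ⊆adj : ∀ v → Towards.neighbours x v ≡ true → adj G x v ≡ true
      ⊆adj v h with adj G x v in a
      ... | true = refl
      ... | false = trans (sym a) (subst (λ z → adj G z v ≡ true) unmatched (∧-conicalˡ _ _ h))
  ... | no matched = ≤-trans (count-∨ (adj G x minus mate x) (adj G (mate x) minus x))
      (sum-of-two-below (below x (mate x) (matched⇒adj matched))
                        (below (mate x) x (trans (adj-sym G (mate x) x) (matched⇒adj matched))))
    where
      below : ∀ v u → adj G v u ≡ true → count (adj G v minus u) < Δ
      below v u a = ≤-trans (≤-reflexive (sym (count-remove (adj G v) a))) (degree≤ v)

  contracted-degree : ∀ {Δ} → (∀ v → degree G v ≤ Δ) → ∀ x → count (contracted x) ≤ Δ ℕ.+ (Δ ℕ.∸ 2)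
  contracted-degree degree≤ x =
    ≤-trans (count-injective towards towards-neighbour towards-injective) (neighbours-bound degree≤ x)
    where open Towards x

  contracted-colouring : ∀ d → (∀ v → degree G v ≤ suc d) → ProperColouring contracted (suc (2 ℕ.* d))
  contracted-colouring zero degree≤ = maxDegree≤1⇒colourable (contracted-degree degree≤)
  contracted-colouring (suc e) degree≤ =
    Vizing.vizing contracted contracted-sym contracted-irrefl (suc (2 ℕ.* suc e))
      (λ v → s≤s (≤-trans (contracted-degree degree≤ v) (≤-reflexive (arithmetic e))))
    where
      arithmetic : ∀ e → suc (suc e) ℕ.+ e ≡ 2 ℕ.* suc e
      arithmetic e = cong suc (trans (sym (+-suc e e)) (cong (e ℕ.+_) (sym (+-identityʳ (suc e)))))

-- Blocks of a colour class

module Blocks {n : ℕ} (G : Graph n) (M : Matching G) (triangle-free : TriangleFree G)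
  {k : ℕ} (χ : ProperColouring (Contraction.contracted G M) k) where

  open Contraction G M
  open ProperColouring χ

  Partner : Fin k → Fin n → Fin n → Set
  Partner c r s = contracted r s ≡ true × colour r s ≡ c

  partner? : ∀ c r → Dec (∃ (Partner c r))
  partner? c r = any? (λ s → (contracted r s Bool.≟ true) ×-dec (colour r s ≟ c))

  Partner-sym : ∀ {c r s} → Partner c r s → Partner c s r
  Partner-sym {r = r} {s} (e , col) = trans (contracted-sym s r) e , trans (colour-sym s r) col

  Partner-unique : ∀ {c r s s′} → Partner c r s → Partner c r s′ → s ≡ s′
  Partner-unique {r = r} (e , col) (e′ , col′) = proper r _ _ e e′ (trans col (sym col′))

  -- For colour c, the units joined by c-coloured edges of the contracted graph form blocks of at most
  -- two units, named by the smaller representative.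
  opaque
    blockOfUnit : Fin k → Fin n → Fin n
    blockOfUnit c r with partner? c r
    ... | yes (s , _) = r ⊓ s
    ... | no _ = r

    blockOfUnit-cases : ∀ c r → blockOfUnit c r ≡ r ⊎ ∃ λ s → Partner c r s × blockOfUnit c r ≡ s
    blockOfUnit-cases c r with partner? c r
    ... | no _ = inj₁ refl
    ... | yes (s , p) with ⊓-sel r s
    ...   | inj₁ e = inj₁ e
    ...   | inj₂ e = inj₂ (s , p , e)

    blockOfUnit-partner : ∀ {c r s} → Partner c r s → blockOfUnit c r ≡ r ⊓ s
    blockOfUnit-partner {c} {r} p with partner? c r
    ... | yes (s′ , p′) = cong (r ⊓_) (Partner-unique p′ p)
    ... | no none = ⊥-elim (none (_ , p))

  Link : Fin n → Fin n → Fin n → Fin n → Set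
  Link r s u a = rep u ≡ r × rep a ≡ s × adj G u a ≡ true

  link? : ∀ r s → Dec (∃₂ (Link r s))
  link? r s = any? (λ u → any? (λ a → (rep u ≟ r) ×-dec (rep a ≟ s) ×-dec (adj G u a Bool.≟ true)))

  -- Triangle-freeness: all edges between two units join the same ends, or the opposite ones.
  link-parity : ∀ {r s u a u′ a′} → Link r s u a → Link r s u′ a′ → notRep u xor notRep a ≡ notRep u′ xor notRep a′
  link-parity {u = u} {a} {u′} {a′} (ru , ra , ua) (ru′ , ra′ , ua′)
    with same-unit {u} {u′} (trans ru (sym ru′)) | same-unit {a} {a′} (trans ra (sym ra′))
  ... | inj₁ refl | inj₁ refl = refl
  ... | inj₁ refl | inj₂ (refl , matched) = ⊥-elim (triangle-free u a (mate a) (ua , matched⇒adj matched , ua′))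
  ... | inj₂ (refl , matched) | inj₁ refl = ⊥-elim (triangle-free u (mate u) a (matched⇒adj matched , ua′ , ua))
  ... | inj₂ (refl , matched) | inj₂ (refl , matched′)
    rewrite notRep-mate matched | notRep-mate matched′ = sym (xor-annihilates-not (notRep u) (notRep a))

  opaque
    parity : Fin n → Fin n → Bool
    parity r s with link? r s
    ... | yes (u , a , _) = not (notRep u xor notRep a)
    ... | no _ = false

    parity-link : ∀ {r s u a} → Link r s u a → parity r s ≡ not (notRep u xor notRep a)
    parity-link {r} {s} l with link? r s
    ... | yes (_ , _ , l′) = cong not (link-parity l′ l)
    ... | no none = ⊥-elim (none (_ , _ , l))

  -- In a block of units r < s, s is flipped exactly when the edges between r and s join ends with
  -- equal notRep, so that all of them join opposite orientations.
  opaque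
    flipOfUnit : Fin k → Fin n → Bool
    flipOfUnit c r with partner? c r
    ... | yes (s , _) = if does (r ⊓ s ≟ r) then false else parity r s
    ... | no _ = false

    flipOfUnit-partner : ∀ {c r s} → Partner c r s → flipOfUnit c r ≡ (if does (r ⊓ s ≟ r) then false else parity r s)
    flipOfUnit-partner {c} {r} p with partner? c r
    ... | yes (s′ , p′) rewrite Partner-unique p′ p = refl
    ... | no none = ⊥-elim (none (_ , p))

  flipOfUnit-smaller : ∀ {c r s} → Partner c r s → r ⊓ s ≡ r → flipOfUnit c r ≡ false
  flipOfUnit-smaller {r = r} {s} p smaller =
    trans (flipOfUnit-partner p) (cong (if_then false else parity r s) (dec-true (r ⊓ s ≟ r) smaller))

  flipOfUnit-larger : ∀ {c r s} → Partner c r s → r ⊓ s ≢ r → flipOfUnit c r ≡ parity r s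
  flipOfUnit-larger {r = r} {s} p larger =
    trans (flipOfUnit-partner p) (cong (if_then false else parity r s) (dec-false (r ⊓ s ≟ r) larger))

  block : Fin k → Fin n → Fin n
  block c v = blockOfUnit c (rep v)

  orientation : Fin k → Fin n → Bool
  orientation c v = flipOfUnit c (rep v) xor notRep v

  matching-edge-in-block : ∀ c {u v} → medge M u v ≡ true → block c u ≡ block c v × orientation c u ≢ orientation c v
  matching-edge-in-block c {u} {v} m = same-block , λ e → not-¬ refl (trans e flipped)
    where
      v≡mate : v ≡ mate u
      v≡mate = sym (medge⇒mate m)
      same-block : block c u ≡ block c v
      same-block = cong (blockOfUnit c) (trans (sym (rep-mate u)) (cong rep (sym v≡mate)))
      flipped : orientation c v ≡ not (orientation c u)
      flipped = trans (cong₂ _xor_ (cong (flipOfUnit c) (trans (cong rep v≡mate) (rep-mate u)))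
                                   (trans (cong notRep v≡mate) (notRep-mate (medge⇒matched m))))
                      (sym (not-distribʳ-xor (flipOfUnit c (rep u)) (notRep u)))

  coloured-edge-in-block : ∀ c {u v} → adj G u v ≡ true → medge M u v ≡ false → colour (rep u) (rep v) ≡ c →
                           block c u ≡ block c v × orientation c u ≢ orientation c v
  coloured-edge-in-block c {u} {v} a m col = same-block , opposite (⊓-sel (rep u) (rep v))
    where
      r = rep u
      s = rep v
      p : Partner c r s
      p = edge⇒contracted a m , col
      r≢s : r ≢ s
      r≢s = non-matching-edge⇒distinct-units a m
      same-block : block c u ≡ block c v
      same-block = trans (blockOfUnit-partner p) (trans (⊓-comm r s) (sym (blockOfUnit-partner (Partner-sym p))))
      opposite : r ⊓ s ≡ r ⊎ r ⊓ s ≡ s → orientation c u ≢ orientation c v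
      opposite (inj₁ r-first) e = not-¬ refl (trans (sym θu) (trans e θv))
        where
          θu : orientation c u ≡ notRep u
          θu = cong (_xor notRep u) (flipOfUnit-smaller p r-first)
          θv : orientation c v ≡ not (notRep u)
          θv = trans (cong (_xor notRep v) (trans (flipOfUnit-larger (Partner-sym p)
                                                       (λ e′ → r≢s (trans (sym r-first) (trans (⊓-comm r s) e′))))
                                              (parity-link (refl , refl , trans (adj-sym G v u) a))))
                     (xor-other-end (notRep u) (notRep v))
      opposite (inj₂ s-first) e = not-¬ refl (trans (sym θv) (trans (sym e) θu))
        where
          θv : orientation c v ≡ notRep v
          θv = cong (_xor notRep v) (flipOfUnit-smaller (Partner-sym p) (trans (⊓-comm s r) s-first))
          θu : orientation c u ≡ not (notRep v)
          θu = trans (cong (_xor notRep u) (trans (flipOfUnit-larger p (λ e′ → r≢s (trans (sym e′) s-first)))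
                                              (parity-link (refl , refl , a))))
                     (xor-other-end (notRep v) (notRep u))

  other-edge-across-blocks : ∀ c {u v} → adj G u v ≡ true → medge M u v ≡ false → colour (rep u) (rep v) ≢ c →
                             block c u ≢ block c v
  other-edge-across-blocks c {u} {v} a m col≢c e with blockOfUnit-cases c (rep u) | blockOfUnit-cases c (rep v)
  ... | inj₁ x | inj₁ y = r≢s (trans (sym x) (trans e y))
    where r≢s = non-matching-edge⇒distinct-units a m
  ... | inj₁ x | inj₂ (q , (_ , colq) , y) =
    col≢c (trans (colour-sym (rep u) (rep v)) (subst (λ z → colour (rep v) z ≡ c) (sym (trans (sym x) (trans e y))) colq))
  ... | inj₂ (q , (_ , colq) , x) | inj₁ y =
    col≢c (subst (λ z → colour (rep u) z ≡ c) (trans (sym x) (trans e y)) colq)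
  ... | inj₂ (q , pq , x) | inj₂ (q′ , pq′ , y) =
    non-matching-edge⇒distinct-units a m
      (Partner-unique (Partner-sym pq) (Partner-sym (subst (Partner c (rep v)) (sym (trans (sym x) (trans e y))) pq′)))

-- Averaging over random cuts

allSubsets-complete : ∀ n (A : Vec Bool n) → A ∈ allSubsets n
allSubsets-complete zero [] = here refl
allSubsets-complete (suc n) (true ∷ A) = ∈-++⁺ˡ (∈-map⁺ (true ∷_) (allSubsets-complete n A))
allSubsets-complete (suc n) (false ∷ A) = ∈-++⁺ʳ (map (true ∷_) (allSubsets n)) (∈-map⁺ (false ∷_) (allSubsets-complete n A))

foldr-⊔-upper : ∀ {A : Set} (f : A → ℚ) {L : List A} {x} → x ∈ L → f x ≤ℚ foldr (λ a m → f a ⊔ m) 0ℚ L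
foldr-⊔-upper f (here refl) = ℚ.p≤p⊔q (f _) _
foldr-⊔-upper f {y ∷ L} (there x∈L) = ℚ.≤-trans (foldr-⊔-upper f x∈L) (ℚ.p≤q⊔p (f y) _)

cutWeight≤mac : ∀ {n} (G : Graph n) (W : Weight G) A → cutWeight G W A ≤ℚ mac G W
cutWeight≤mac {n} G W A = foldr-⊔-upper (cutWeight G W) (allSubsets-complete n A)

differ≗xor : ∀ a b → differ a b ≡ a xor b
differ≗xor true true = refl
differ≗xor true false = refl
differ≗xor false true = refl
differ≗xor false false = refl

module AverageCut (d : ℕ) {n : ℕ} (G : Graph n) (W : Weight G) (triangle-free : TriangleFree G) (M : Matching G)
  (χ : ProperColouring (Contraction.contracted G M) (suc (2 ℕ.* d))) where

  open Contraction G M using (rep)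
  open ProperColouring χ using (colour)

  k : ℕ
  k = suc (2 ℕ.* d)

  open Blocks G M triangle-free χ

  -- X flips every block independently; only its entries at block names matter.
  side : Fin k → Vec Bool n → Fin n → Bool
  side c X v = lookup X (block c v) xor orientation c v

  partition : Fin k → Vec Bool n → Vec Bool n
  partition c X = tabulate (side c X)

  N : ℚ
  N = Σᵛ {n} (λ _ → 1ℚ)

  cutTerm : Fin k → Vec Bool n → Fin n → Fin n → ℚ
  cutTerm c X u v = if (adj G u v ∧ differ (lookup (partition c X) u) (lookup (partition c X) v)) ∧ (toℕ u <ᵇ toℕ v)
                    then w W u v else 0ℚ

  cutTerm-edge : ∀ {c X u v} → adj G u v ≡ true → (toℕ u <ᵇ toℕ v) ≡ true →
                 cutTerm c X u v ≡ (if side c X u xor side c X v then w W u v else 0ℚ)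
  cutTerm-edge {c} {X} {u} {v} a l = cong (if_then w W u v else 0ℚ) (begin
    (adj G u v ∧ differ (lookup (partition c X) u) (lookup (partition c X) v)) ∧ (toℕ u <ᵇ toℕ v)
      ≡⟨ cong₂ _∧_ (cong₂ _∧_ a (cong₂ differ (lookup∘tabulate (side c X) u) (lookup∘tabulate (side c X) v))) l ⟩
    differ (side c X u) (side c X v) ∧ true
      ≡⟨ ∧-identityʳ _ ⟩
    differ (side c X u) (side c X v)
      ≡⟨ differ≗xor _ _ ⟩
    side c X u xor side c X v ∎)

  always-cut : ∀ {c u v} → adj G u v ≡ true → (toℕ u <ᵇ toℕ v) ≡ true →
               block c u ≡ block c v → orientation c u ≢ orientation c v → Σᵛ (λ X → cutTerm c X u v) ≡ N * w W u v
  always-cut {c} {u} {v} a l same opposite = trans (Σᵛ-cong cut) (Σᵛ-const {n} (w W u v))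
    where
      cut : ∀ X → cutTerm c X u v ≡ w W u v
      cut X = trans (cutTerm-edge {c} {X} a l) (cong (if_then w W u v else 0ℚ)
                (subst (λ b → (lookup X (block c u) xor orientation c u) xor (lookup X b xor orientation c v) ≡ true) same
                  (xor-apart (lookup X (block c u)) opposite)))

  half-cut : ∀ {c u v} → adj G u v ≡ true → (toℕ u <ᵇ toℕ v) ≡ true →
             block c u ≢ block c v → Σᵛ (λ X → cutTerm c X u v) ≡ ½ * (N * w W u v)
  half-cut {c} {u} {v} a l apart =
    trans (Σᵛ-cong (λ X → cutTerm-edge {c} {X} a l))
          (trans (Σᵛ-separated apart (orientation c u) (orientation c v) (w W u v)) (cong (½ *_) (Σᵛ-const {n} (w W u v))))

  edgeWeight : (Fin n → Fin n → Bool) → Fin n → Fin n → ℚ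
  edgeWeight S u v = if S u v ∧ (toℕ u <ᵇ toℕ v) then w W u v else 0ℚ

  edgeWeight-on : ∀ S {u v} → S u v ≡ true → (toℕ u <ᵇ toℕ v) ≡ true → edgeWeight S u v ≡ w W u v
  edgeWeight-on S e l rewrite e | l = refl

  edgeWeight-offˡ : ∀ S {u v} → S u v ≡ false → edgeWeight S u v ≡ 0ℚ
  edgeWeight-offˡ S e rewrite e = refl

  edgeWeight-offʳ : ∀ S {u v} → (toℕ u <ᵇ toℕ v) ≡ false → edgeWeight S u v ≡ 0ℚ
  edgeWeight-offʳ S {u} {v} l rewrite l | ∧-zeroʳ (S u v) = refl

  cutTerm-offˡ : ∀ {c X u v} → adj G u v ≡ false → cutTerm c X u v ≡ 0ℚ
  cutTerm-offˡ {c} {X} {u} {v} a =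
    cong (λ b → if (b ∧ cut) ∧ (toℕ u <ᵇ toℕ v) then w W u v else 0ℚ) a
    where cut = differ (lookup (partition c X) u) (lookup (partition c X) v)

  cutTerm-offʳ : ∀ {c X u v} → (toℕ u <ᵇ toℕ v) ≡ false → cutTerm c X u v ≡ 0ℚ
  cutTerm-offʳ {c} {X} {u} {v} l =
    cong (if_then w W u v else 0ℚ) (trans (cong (cut ∧_) l) (∧-zeroʳ cut))
    where cut = adj G u v ∧ differ (lookup (partition c X) u) (lookup (partition c X) v)

  toℚ-k : toℚ k ≡ toℚ (suc d) + toℚ d
  toℚ-k = trans (cong (λ t → toℚ (suc (d ℕ.+ t))) (+-identityʳ d)) (toℚ-+ (suc d) d)

  toℚ-2d : toℚ (2 ℕ.* d) ≡ toℚ d + toℚ d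
  toℚ-2d = trans (cong (λ t → toℚ (d ℕ.+ t)) (+-identityʳ d)) (toℚ-+ d d)

  cutTotal : Fin n → Fin n → ℚ
  cutTotal u v = Σℚ {k} (λ c → Σᵛ (λ X → cutTerm c X u v))

  edgeShare : Fin n → Fin n → ℚ
  edgeShare u v = N * (toℚ (suc d) * edgeWeight (adj G) u v + toℚ d * edgeWeight (medge M) u v)

  non-edge-share : ∀ {u v} → (∀ c X → cutTerm c X u v ≡ 0ℚ) →
                   edgeWeight (adj G) u v ≡ 0ℚ → edgeWeight (medge M) u v ≡ 0ℚ → cutTotal u v ≡ edgeShare u v
  non-edge-share {u} {v} zero-term zero-adj zero-medge = begin
    cutTotal u v
      ≡⟨ Σℚ-cong (λ c → trans (Σᵛ-cong (zero-term c)) (Σᵛ-const {n} 0ℚ)) ⟩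
    Σℚ {k} (λ _ → N * 0ℚ)
      ≡⟨ Σℚ-const k (N * 0ℚ) ⟩
    toℚ k * (N * 0ℚ)
      ≡⟨ solve 4 (λ K N D d → K :* (N :* con 0ℚ) := N :* (D :* con 0ℚ :+ d :* con 0ℚ)) refl
                 (toℚ k) N (toℚ (suc d)) (toℚ d) ⟩
    N * (toℚ (suc d) * 0ℚ + toℚ d * 0ℚ)
      ≡⟨ cong₂ (λ x y → N * (toℚ (suc d) * x + toℚ d * y)) (sym zero-adj) (sym zero-medge) ⟩
    edgeShare u v ∎

  matching-edge-share : ∀ {u v} → adj G u v ≡ true → (toℕ u <ᵇ toℕ v) ≡ true → medge M u v ≡ true →
                        cutTotal u v ≡ edgeShare u v
  matching-edge-share {u} {v} a l m = begin
    cutTotal u v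
      ≡⟨ Σℚ-cong (λ c → uncurry (always-cut {c} a l) (matching-edge-in-block c m)) ⟩
    Σℚ {k} (λ _ → N * ω)
      ≡⟨ Σℚ-const k (N * ω) ⟩
    toℚ k * (N * ω)
      ≡⟨ cong (_* (N * ω)) toℚ-k ⟩
    (toℚ (suc d) + toℚ d) * (N * ω)
      ≡⟨ solve 4 (λ D d N ω → (D :+ d) :* (N :* ω) := N :* (D :* ω :+ d :* ω)) refl (toℚ (suc d)) (toℚ d) N ω ⟩
    N * (toℚ (suc d) * ω + toℚ d * ω)
      ≡⟨ cong₂ (λ x y → N * (toℚ (suc d) * x + toℚ d * y))
               (sym (edgeWeight-on (adj G) a l)) (sym (edgeWeight-on (medge M) m l)) ⟩
    edgeShare u v ∎
    where ω = w W u v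

  -- Only the colour c₀ of the edge in G/M puts it inside a block; the other 2d colours cut it half
  -- the time.
  other-edge-share : ∀ {u v} → adj G u v ≡ true → (toℕ u <ᵇ toℕ v) ≡ true → medge M u v ≡ false →
                     cutTotal u v ≡ edgeShare u v
  other-edge-share {u} {v} a l m = begin
    cutTotal u v
      ≡⟨ Σℚ-except (λ c → Σᵛ (λ X → cutTerm c X u v)) c₀
                   (λ c c≢c₀ → half-cut {c} a l (other-edge-across-blocks c a m (λ e → c≢c₀ (sym e)))) ⟩
    Σᵛ (λ X → cutTerm c₀ X u v) + toℚ (2 ℕ.* d) * (½ * (N * ω))
      ≡⟨ cong₂ (λ x y → x + y * (½ * (N * ω))) (uncurry (always-cut {c₀} a l) (coloured-edge-in-block c₀ a m refl)) toℚ-2d ⟩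
    N * ω + (toℚ d + toℚ d) * (½ * (N * ω))
      ≡⟨ solve 3 (λ d N ω → N :* ω :+ (d :+ d) :* (con ½ :* (N :* ω)) := N :* ((con 1ℚ :+ d) :* ω :+ d :* con 0ℚ))
                 refl (toℚ d) N ω ⟩
    N * ((1ℚ + toℚ d) * ω + toℚ d * 0ℚ)
      ≡⟨ cong₂ (λ x y → N * (x * ω + toℚ d * y)) (sym (toℚ-+ 1 d)) (sym (edgeWeight-offˡ (medge M) m)) ⟩
    N * (toℚ (suc d) * ω + toℚ d * edgeWeight (medge M) u v)
      ≡⟨ cong (λ x → N * (toℚ (suc d) * x + toℚ d * edgeWeight (medge M) u v)) (sym (edgeWeight-on (adj G) a l)) ⟩
    edgeShare u v ∎
    where
      ω = w W u v
      c₀ = colour (rep u) (rep v)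

  edge-share : ∀ u v → cutTotal u v ≡ edgeShare u v
  edge-share u v = byCase (adj G u v) (toℕ u <ᵇ toℕ v) (medge M u v) refl refl refl
    where
      byCase : ∀ a l m → adj G u v ≡ a → (toℕ u <ᵇ toℕ v) ≡ l → medge M u v ≡ m → cutTotal u v ≡ edgeShare u v
      byCase true true true a l m = matching-edge-share a l m
      byCase true true false a l m = other-edge-share a l m
      byCase true false _ a l m =
        non-edge-share (λ c X → cutTerm-offʳ {c} {X} l) (edgeWeight-offʳ (adj G) l) (edgeWeight-offʳ (medge M) l)
      byCase false _ true a l m = ⊥-elim (true≢false (trans (sym (m-sub M u v m)) a))
      byCase false _ false a l m =
        non-edge-share (λ c X → cutTerm-offˡ {c} {X} a) (edgeWeight-offˡ (adj G) a) (edgeWeight-offˡ (medge M) m)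

  total : ℚ
  total = Σℚ {k} (λ c → Σᵛ (λ X → cutWeight G W (partition c X)))

  total≡ : total ≡ N * (toℚ (suc d) * wG G W + toℚ d * wM W M)
  total≡ = begin
    Σℚ (λ c → Σᵛ (λ X → Σℚ (λ u → Σℚ (λ v → cutTerm c X u v))))
      ≡⟨ Σℚ-cong (λ c → trans (Σᵛ-Σℚ (λ X u → Σℚ (cutTerm c X u))) (Σℚ-cong (λ u → Σᵛ-Σℚ (λ X v → cutTerm c X u v)))) ⟩
    Σℚ (λ c → Σℚ (λ u → Σℚ (λ v → Σᵛ (λ X → cutTerm c X u v))))
      ≡⟨ Σℚ-swap (λ c u → Σℚ (λ v → Σᵛ (λ X → cutTerm c X u v))) ⟩
    Σℚ (λ u → Σℚ (λ c → Σℚ (λ v → Σᵛ (λ X → cutTerm c X u v))))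
      ≡⟨ Σℚ-cong (λ u → Σℚ-swap (λ c v → Σᵛ (λ X → cutTerm c X u v))) ⟩
    Σℚ (λ u → Σℚ (λ v → Σℚ (λ c → Σᵛ (λ X → cutTerm c X u v))))
      ≡⟨ Σℚ-cong (λ u → Σℚ-cong (λ v → edge-share u v)) ⟩
    Σℚ (λ u → Σℚ (λ v → N * (toℚ (suc d) * edgeWeight (adj G) u v + toℚ d * edgeWeight (medge M) u v)))
      ≡⟨ Σℚ-cong (λ u → Σℚ-linear N (toℚ (suc d)) (toℚ d) (edgeWeight (adj G) u) (edgeWeight (medge M) u)) ⟩
    Σℚ (λ u → N * (toℚ (suc d) * Σℚ (edgeWeight (adj G) u) + toℚ d * Σℚ (edgeWeight (medge M) u)))
      ≡⟨ Σℚ-linear N (toℚ (suc d)) (toℚ d) (λ u → Σℚ (edgeWeight (adj G) u)) (λ u → Σℚ (edgeWeight (medge M) u)) ⟩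
    N * (toℚ (suc d) * wG G W + toℚ d * wM W M) ∎

  total≤ : total ≤ℚ N * (toℚ k * mac G W)
  total≤ = ℚ.≤-trans (Σℚ-mono (λ c → Σᵛ-mono (λ X → cutWeight≤mac G W (partition c X))))
    (ℚ.≤-reflexive (trans (Σℚ-cong {k} (λ _ → Σᵛ-const {n} (mac G W)))
                 (trans (Σℚ-const k (N * mac G W))
                        (solve 3 (λ K N m → K :* (N :* m) := N :* (K :* m)) refl (toℚ k) N (mac G W)))))

  weighted-bound : toℚ (suc d) * wG G W + toℚ d * wM W M ≤ℚ toℚ k * mac G W
  weighted-bound = ℚ.*-cancelˡ-≤-pos N {{Σᵛ-1-positive n}} (subst (_≤ℚ N * (toℚ k * mac G W)) total≡ total≤)

  matching-cut-bound : coeff (suc d) * (wG G W - wM W M) + wM W M ≤ℚ mac G W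
  matching-cut-bound = ℚ.*-cancelʳ-≤-pos (toℚ k) {{ℚ.normalize-pos k 1}}
    (subst₂ _≤ℚ_ (sym scaled) (ℚ.*-comm (toℚ k) (mac G W)) weighted-bound)
    where
      scaled : (coeff (suc d) * (wG G W - wM W M) + wM W M) * toℚ k ≡ toℚ (suc d) * wG G W + toℚ d * wM W M
      scaled = begin
        (coeff (suc d) * (wG G W - wM W M) + wM W M) * toℚ k
          ≡⟨ solve 4 (λ c g m K → (c :* (g :- m) :+ m) :* K := (c :* K) :* (g :- m) :+ K :* m) refl
                     (coeff (suc d)) (wG G W) (wM W M) (toℚ k) ⟩
        (coeff (suc d) * toℚ k) * (wG G W - wM W M) + toℚ k * wM W M
          ≡⟨ cong₂ (λ x y → x * (wG G W - wM W M) + y * wM W M) (coeff-suc d) toℚ-k ⟩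
        toℚ (suc d) * (wG G W - wM W M) + (toℚ (suc d) + toℚ d) * wM W M
          ≡⟨ solve 4 (λ D d g m → D :* (g :- m) :+ (D :+ d) :* m := D :* g :+ d :* m) refl
                     (toℚ (suc d)) (toℚ d) (wG G W) (wM W M) ⟩
        toℚ (suc d) * wG G W + toℚ d * wM W M ∎

lemma5p11 : (Δ : ℕ) → 1 ≤ Δ → {n : ℕ} (G : Graph n) (W : Weight G) →
    Connected G → TriangleFree G → (∀ v → degree G v ≤ Δ) →
    (M : Matching G) →
    (coeff Δ * (wG G W - wM W M) + wM W M) ≤ℚ mac G W
lemma5p11 (suc d) _ G W _ triangle-free degree≤ M =
  AverageCut.matching-cut-bound d G W triangle-free M (Contraction.contracted-colouring G M d degree≤)
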